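{- Let $\Pi_q$ be a projective plane of order $q$, let $t<q-1$, and let $\mathcal{S}$ be a $t$-semiarc of $V_t^\circ$ type in $\Pi_q$. Then: (a) $|\mathcal{S}|\neq 2q-2t+1$. (b) If $t=2$, then either $\mathcal{S}$ is a $V_2$-configuration, or $|\mathcal{S}|=2q-2$ and there exist a Fano subplane $\Pi_2$ of $\Pi_q$ and two lines $\ell_1,\ell_2$ of $\Pi_q$ whose intersections with $\Pi_2$ are lines of $\Pi_2$ such that $\mathcal{S}=(\ell_1\cup\ell_2)\triangle\Pi_2$ (where $\Pi_2$ denotes its point set). (c) If $t>1$, then $|\mathcal{S}|\leq 2q-t$.
   Context: A non-empty point set $\mathcal{S}$ of $\Pi_q$ is a $t$-semiarc if for every point $P\in\mathcal{S}$ there are exactly $t$ lines $\ell$ with $\ell\cap\mathcal{S}=\{P\}$ (tangents at $P$). $A\triangle B$ denotes the symmetric difference $(A\setminus B)\cup(B\setminus A)$. For two distinct lines $\ell_1,\ell_2$, a $V_t$-configuration is a set obtained from $\ell_1\triangle\ell_2$ by removing $t$ further points from each of $\ell_1\setminus\ell_2$ and $\ell_2\setminus\ell_1$ (so it has $2(q-t)$ points). $\mathcal{S}$ is of $V_t^\circ$ type if there are two distinct lines $\ell_1,\ell_2$ with $\ell_1\cap\ell_2\notin\mathcal{S}$ such that $(\ell_1\triangle\ell_2)\cap\mathcal{S}$ is a $V_t$-configuration with respect to $\ell_1,\ell_2$. A Fano subplane is a subplane of order 2. -}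

module Defs where

open import Data.Nat using (ℕ; zero; suc; _+_; _*_; _∸_; _<_; _≤_)
open import Data.Bool using (Bool; true; false)
import Data.Bool.Properties as BoolP
open import Data.Fin using (Fin)
open import Data.Fin.Subset using (Subset; _∈_; _∉_; _⊆_; _∩_; _∪_; _─_; ∣_∣; ⁅_⁆; Nonempty)
open import Data.Vec using (tabulate)
open import Data.Vec.Properties using (≡-dec)
open import Data.Product using (Σ; ∃; ∃-syntax; _×_; _,_)
open import Relation.Nullary using (¬_; does)
open import Relation.Binary.PropositionalEquality using (_≡_; _≢_)

numPts : ℕ → ℕ
numPts q = q * q + q + 1

_△_ : ∀ {n} → Subset n → Subset n → Subset n
A △ B = (A ─ B) ∪ (B ─ A)

-- Points and lines are both indexed by
-- Fin (q²+q+1) (a consequence of the axioms, fixed here for convenience);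
-- incidence is a Boolean relation  inc P ℓ  (point P lies on line ℓ).
record ProjectivePlane (q : ℕ) : Set where
  field
    inc : Fin (numPts q) → Fin (numPts q) → Bool

  Point : Set
  Point = Fin (numPts q)

  Line : Set
  Line = Fin (numPts q)

  L : Line → Subset (numPts q)
  L ℓ = tabulate (λ P → inc P ℓ)

  Collinear : Point → Point → Point → Set
  Collinear P Q R = ∃[ ℓ ] (P ∈ L ℓ × Q ∈ L ℓ × R ∈ L ℓ)

  field
    join      : ∀ P Q → P ≢ Q → ∃[ ℓ ] (P ∈ L ℓ × Q ∈ L ℓ)
    join-uniq : ∀ P Q → P ≢ Q → ∀ ℓ m →
                P ∈ L ℓ → Q ∈ L ℓ → P ∈ L m → Q ∈ L m → ℓ ≡ m
    meet      : ∀ ℓ m → ℓ ≢ m → ∃[ P ] (P ∈ L ℓ × P ∈ L m)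
    meet-uniq : ∀ ℓ m → ℓ ≢ m → ∀ P Q →
                P ∈ L ℓ → P ∈ L m → Q ∈ L ℓ → Q ∈ L m → P ≡ Q
    quadrangle : ∃[ A ] ∃[ B ] ∃[ C ] ∃[ D ]
                 (¬ Collinear A B C × ¬ Collinear A B D ×
                  ¬ Collinear A C D × ¬ Collinear B C D)
    line-size : ∀ ℓ → ∣ L ℓ ∣ ≡ suc q

module _ {q : ℕ} (Π : ProjectivePlane q) where
  open ProjectivePlane Π

  tangents : Subset (numPts q) → Point → Subset (numPts q)
  tangents S P = tabulate (λ ℓ → does (≡-dec BoolP._≟_ (L ℓ ∩ S) ⁅ P ⁆))

  IsSemiarc : ℕ → Subset (numPts q) → Set
  IsSemiarc t S = Nonempty S × (∀ P → P ∈ S → ∣ tangents S P ∣ ≡ t)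

  IsVConfigWrt : ℕ → Line → Line → Subset (numPts q) → Set
  IsVConfigWrt t ℓ₁ ℓ₂ V =
    ℓ₁ ≢ ℓ₂ ×
    ∃[ R₁ ] ∃[ R₂ ] (R₁ ⊆ (L ℓ₁ ─ L ℓ₂) × ∣ R₁ ∣ ≡ t ×
                     R₂ ⊆ (L ℓ₂ ─ L ℓ₁) × ∣ R₂ ∣ ≡ t ×
                     V ≡ (L ℓ₁ △ L ℓ₂) ─ (R₁ ∪ R₂))

  IsVConfig : ℕ → Subset (numPts q) → Set
  IsVConfig t V = ∃[ ℓ₁ ] ∃[ ℓ₂ ] IsVConfigWrt t ℓ₁ ℓ₂ V

  IsVcircType : ℕ → Subset (numPts q) → Set
  IsVcircType t S =
    ∃[ ℓ₁ ] ∃[ ℓ₂ ] (ℓ₁ ≢ ℓ₂ ×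
      (∀ X → X ∈ L ℓ₁ → X ∈ L ℓ₂ → X ∉ S) ×
      IsVConfigWrt t ℓ₁ ℓ₂ ((L ℓ₁ △ L ℓ₂) ∩ S))

  IsFanoSubplane : Subset (numPts q) → Subset (numPts q) → Set
  IsFanoSubplane Πs Λ =
    (∀ P Q → P ∈ Πs → Q ∈ Πs → P ≢ Q → ∃[ ℓ ] (ℓ ∈ Λ × P ∈ L ℓ × Q ∈ L ℓ)) ×
    (∀ ℓ m → ℓ ∈ Λ → m ∈ Λ → ℓ ≢ m → ∃[ P ] (P ∈ Πs × P ∈ L ℓ × P ∈ L m)) ×
    (∃[ A ] ∃[ B ] ∃[ C ] ∃[ D ]
       (A ∈ Πs × B ∈ Πs × C ∈ Πs × D ∈ Πs ×
        ¬ Collinear A B C × ¬ Collinear A B D ×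
        ¬ Collinear A C D × ¬ Collinear B C D)) ×
    (∀ ℓ → ℓ ∈ Λ → ∣ L ℓ ∩ Πs ∣ ≡ 3)

module Submission where

-- Let V = ℓ₁ ∩ ℓ₂ and let T be the set of points of S off ℓ₁ ∪ ℓ₂, so |S| = 2q − 2t + |T|.
-- For P ∈ S ∩ ℓ₂ the t tangents at P meet ℓ₁ exactly in the t missing points R₁, so every line
-- through P and a point of R₁ is a tangent; hence for X ∈ T and r ∈ R₁ the line Xr meets ℓ₂ in a
-- missing point φ r X ∈ R₂. For X ∈ T the t + 1 lines joining X to ℓ₁ ∖ S = R₁ ∪ {V} contain the
-- t tangents at X, so exactly one of them, through the "secant point" of X, meets S again, and
-- it does so in T; thus |T| ≠ 1, which is (a). If some r ∈ R₁ is the secant point of no X ∈ T,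
-- then φ r embeds T into R₂ and |T| ≤ t; otherwise counting secant points forces t = 1, giving (c).
-- For t = 2 and T ≠ ∅ one gets T = {X, X′} with secant point V; writing R₁ = {a, b} and
-- R₂ = {c, d}, the quadrangle a, b, c, d has the collinear diagonal points V, X, X′ and so spans
-- a Fano subplane whose points off ℓ₁ ∪ ℓ₂ are exactly T, giving (b).

open import Defs
open import Data.Nat using (ℕ; zero; suc; _+_; _*_; _∸_; _<_; _≤_; z≤n; s≤s; s≤s⁻¹)
import Data.Nat.Properties as ℕ
open import Data.Bool using (true; false)
import Data.Bool.Properties as Bool
open import Data.Fin using (Fin; zero; suc)
open import Data.Fin.Properties using (_≟_; any?; all?; suc-injective; 0≢1+n)
open import Data.Fin.Subset
open import Data.Fin.Subset.Properties
open import Data.Vec using (Vec; []; _∷_; here; there; tabulate; lookup)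
open import Data.Vec.Properties using (≡-dec; lookup⇒[]=; []=⇒lookup; lookup∘tabulate)
open import Data.Vec.Relation.Unary.All as All using (All; []; _∷_)
open import Data.Vec.Relation.Unary.Any using (here; there; index)
open import Data.Vec.Relation.Unary.Any.Properties using (lookup-index)
open import Data.Vec.Membership.Propositional renaming (_∈_ to _∈ᵥ_) using ()
open import Data.Vec.Membership.Propositional.Properties using (∈-lookup)
open import Data.Vec.Membership.DecPropositional (_≟_ {7}) renaming (_∈?_ to _∈ᵥ?_) using ()
open import Data.Product using (∃-syntax; _×_; _,_; proj₁; proj₂; uncurry)
open import Data.Sum using (_⊎_; inj₁; inj₂; [_,_])
open import Data.Empty using (⊥-elim)
open import Function using (_∘_; case_of_)
open import Function.Definitions using (Injective)
open import Relation.Unary using (Pred; Decidable)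
open import Relation.Nullary using (¬_; Dec; yes; no; does; contradiction)
open import Relation.Nullary.Decidable using (dec-true; toWitness; _×-dec_; _⊎-dec_; _→-dec_; ¬?)
open import Relation.Binary.PropositionalEquality hiding ([_])

module Subsets where

  private variable
    n m : ℕ
    p q : Subset n
    x y : Fin n

  x∈p─q⇒x∉q : ∀ (p q : Subset n) → x ∈ p ─ q → x ∉ q
  x∈p─q⇒x∉q (true ∷ p) (false ∷ q) here = λ ()
  x∈p─q⇒x∉q (_ ∷ p) (_ ∷ q) (there x∈) (there x∈q) = x∈p─q⇒x∉q p q x∈ x∈q

  x∈p─q⁻ : ∀ (p q : Subset n) → x ∈ p ─ q → x ∈ p × x ∉ q
  x∈p─q⁻ p q x∈ = p─q⊆p p q x∈ , x∈p─q⇒x∉q p q x∈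

  x∈p-y⁻ : x ∈ p - y → x ∈ p × x ≢ y
  x∈p-y⁻ {p = p} {y = y} x∈ = proj₁ (x∈p─q⁻ p ⁅ y ⁆ x∈) , λ { refl → x∈p─q⇒x∉q p ⁅ y ⁆ x∈ (x∈⁅x⁆ y) }

  module _ {ℓ} {P : Pred (Fin n) ℓ} (P? : Decidable P) where

    x∈tabulate⁺ : P x → x ∈ tabulate (does ∘ P?)
    x∈tabulate⁺ {x} px = lookup⇒[]= x _ (trans (lookup∘tabulate _ x) (dec-true (P? x) px))

    x∈tabulate⁻ : x ∈ tabulate (does ∘ P?) → P x
    x∈tabulate⁻ {x} x∈ with P? x | trans (sym (lookup∘tabulate (does ∘ P?) x)) ([]=⇒lookup x∈)
    ... | yes px | _ = px
    ... | no _ | ()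

  ∣p∣≡1+∣p-x∣ : x ∈ p → ∣ p ∣ ≡ suc ∣ p - x ∣
  ∣p∣≡1+∣p-x∣ {p = true ∷ p} here = cong suc (sym (cong ∣_∣ (p─⊥≡p p)))
  ∣p∣≡1+∣p-x∣ {p = true ∷ p} (there x∈) = cong suc (∣p∣≡1+∣p-x∣ x∈)
  ∣p∣≡1+∣p-x∣ {p = false ∷ p} (there x∈) = ∣p∣≡1+∣p-x∣ x∈

  ∣p∣≡0⇒Empty : ∣ p ∣ ≡ 0 → Empty p
  ∣p∣≡0⇒Empty ∣p∣≡0 (x , x∈) = ℕ.0≢1+n (trans (sym ∣p∣≡0) (∣p∣≡1+∣p-x∣ x∈))

  Empty⇒∣p∣≡0 : Empty p → ∣ p ∣ ≡ 0
  Empty⇒∣p∣≡0 {n} empty = trans (cong ∣_∣ (Empty-unique empty)) (∣⊥∣≡0 n)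

  0<∣p∣⇒Nonempty : 0 < ∣ p ∣ → Nonempty p
  0<∣p∣⇒Nonempty {p = p} 0<∣p∣ with nonempty? p
  ... | yes ne = ne
  ... | no empty = ⊥-elim (ℕ.<-irrefl (sym (Empty⇒∣p∣≡0 empty)) 0<∣p∣)

  ∣q∣≡∣p∣+∣q─p∣ : p ⊆ q → ∣ q ∣ ≡ ∣ p ∣ + ∣ q ─ p ∣
  ∣q∣≡∣p∣+∣q─p∣ {p = []} {q = []} _ = refl
  ∣q∣≡∣p∣+∣q─p∣ {p = true ∷ p} {q = true ∷ q} p⊆q = cong suc (∣q∣≡∣p∣+∣q─p∣ (drop-∷-⊆ p⊆q))
  ∣q∣≡∣p∣+∣q─p∣ {p = true ∷ p} {q = false ∷ q} p⊆q with () ← p⊆q here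
  ∣q∣≡∣p∣+∣q─p∣ {p = false ∷ p} {q = true ∷ q} p⊆q =
    trans (cong suc (∣q∣≡∣p∣+∣q─p∣ (drop-∷-⊆ p⊆q))) (sym (ℕ.+-suc _ _))
  ∣q∣≡∣p∣+∣q─p∣ {p = false ∷ p} {q = false ∷ q} p⊆q = ∣q∣≡∣p∣+∣q─p∣ (drop-∷-⊆ p⊆q)

  Disjoint : Subset n → Subset n → Set
  Disjoint p q = ∀ {x} → x ∈ p → x ∉ q

  ∣p∪q∣≡∣p∣+∣q∣ : Disjoint p q → ∣ p ∪ q ∣ ≡ ∣ p ∣ + ∣ q ∣
  ∣p∪q∣≡∣p∣+∣q∣ {p = []} {q = []} _ = refl
  ∣p∪q∣≡∣p∣+∣q∣ {p = true ∷ p} {q = true ∷ q} disj = ⊥-elim (disj here here)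
  ∣p∪q∣≡∣p∣+∣q∣ {p = true ∷ p} {q = false ∷ q} disj = cong suc (∣p∪q∣≡∣p∣+∣q∣ (λ x∈p x∈q → disj (there x∈p) (there x∈q)))
  ∣p∪q∣≡∣p∣+∣q∣ {p = false ∷ p} {q = true ∷ q} disj =
    trans (cong suc (∣p∪q∣≡∣p∣+∣q∣ (λ x∈p x∈q → disj (there x∈p) (there x∈q)))) (sym (ℕ.+-suc _ _))
  ∣p∪q∣≡∣p∣+∣q∣ {p = false ∷ p} {q = false ∷ q} disj = ∣p∪q∣≡∣p∣+∣q∣ (λ x∈p x∈q → disj (there x∈p) (there x∈q))

  ∣p∣≤∣q∣-by-injection : (f : Fin n → Fin m) → (∀ {x} → x ∈ p → f x ∈ q) →
    (∀ {x y} → x ∈ p → y ∈ p → f x ≡ f y → x ≡ y) → ∣ p ∣ ≤ ∣ q ∣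
  ∣p∣≤∣q∣-by-injection {p = []} f into inj = z≤n
  ∣p∣≤∣q∣-by-injection {p = false ∷ p} f into inj =
    ∣p∣≤∣q∣-by-injection (f ∘ suc) (into ∘ there) (λ x∈ y∈ e → suc-injective (inj (there x∈) (there y∈) e))
  ∣p∣≤∣q∣-by-injection {p = true ∷ p} {q = q} f into inj = begin
    suc ∣ p ∣            ≤⟨ s≤s (∣p∣≤∣q∣-by-injection (f ∘ suc) into′ (λ x∈ y∈ e → suc-injective (inj (there x∈) (there y∈) e))) ⟩
    suc ∣ q - f zero ∣   ≡⟨ ∣p∣≡1+∣p-x∣ (into here) ⟨
    ∣ q ∣                ∎
    where
    open ℕ.≤-Reasoning
    into′ : ∀ {x} → x ∈ p → f (suc x) ∈ q - f zero
    into′ x∈ = x∈p∧x≢y⇒x∈p-y (into (there x∈)) (λ e → 0≢1+n (inj here (there x∈) (sym e)))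

  ∣p∣+∣p∣≤∣q∣-by-two-to-one : {p : Subset n} {q : Subset m} (R : Fin m → Fin n → Set) →
    (∀ {x y y′} → x ∈ q → R x y → R x y′ → y ≡ y′) →
    (∀ {y} → y ∈ p → ∃[ x₁ ] ∃[ x₂ ] (x₁ ≢ x₂ × x₁ ∈ q × x₂ ∈ q × R x₁ y × R x₂ y)) →
    ∣ p ∣ + ∣ p ∣ ≤ ∣ q ∣
  ∣p∣+∣p∣≤∣q∣-by-two-to-one {p = []} R functional two = z≤n
  ∣p∣+∣p∣≤∣q∣-by-two-to-one {p = false ∷ p} R functional two =
    ∣p∣+∣p∣≤∣q∣-by-two-to-one (λ x y → R x (suc y)) (λ x∈ r r′ → suc-injective (functional x∈ r r′)) (two ∘ there)
  ∣p∣+∣p∣≤∣q∣-by-two-to-one {n = suc n} {m = m} {p = true ∷ p} {q = q} R functional two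
    with x₁ , x₂ , x₁≢x₂ , x₁∈q , x₂∈q , r₁ , r₂ ← two here = begin
    suc ∣ p ∣ + suc ∣ p ∣      ≡⟨ cong suc (ℕ.+-suc ∣ p ∣ ∣ p ∣) ⟩
    suc (suc (∣ p ∣ + ∣ p ∣))  ≤⟨ s≤s (s≤s (∣p∣+∣p∣≤∣q∣-by-two-to-one R′ functional′ two′)) ⟩
    suc (suc ∣ q - x₁ - x₂ ∣)  ≡⟨ trans (∣p∣≡1+∣p-x∣ x₁∈q) (cong suc (∣p∣≡1+∣p-x∣ x₂∈q-x₁)) ⟨
    ∣ q ∣                      ∎
    where
    open ℕ.≤-Reasoning
    x₂∈q-x₁ : x₂ ∈ q - x₁
    x₂∈q-x₁ = x∈p∧x≢y⇒x∈p-y x₂∈q (x₁≢x₂ ∘ sym)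
    R′ : Fin m → Fin n → Set
    R′ x y = R x (suc y)
    functional′ : ∀ {x y y′} → x ∈ q - x₁ - x₂ → R′ x y → R′ x y′ → y ≡ y′
    functional′ x∈ r r′ = suc-injective (functional (proj₁ (x∈p-y⁻ (proj₁ (x∈p-y⁻ x∈)))) r r′)
    into : ∀ {x y} → x ∈ q → R′ x y → x ∈ q - x₁ - x₂
    into x∈ r = x∈p∧x≢y⇒x∈p-y (x∈p∧x≢y⇒x∈p-y x∈ λ { refl → 0≢1+n (functional x∈ r₁ r) })
                               λ { refl → 0≢1+n (functional x∈ r₂ r) }
    two′ : ∀ {y} → y ∈ p → ∃[ z₁ ] ∃[ z₂ ] (z₁ ≢ z₂ × z₁ ∈ q - x₁ - x₂ × z₂ ∈ q - x₁ - x₂ × R′ z₁ y × R′ z₂ y)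
    two′ y∈ with z₁ , z₂ , z₁≢z₂ , z₁∈ , z₂∈ , s₁ , s₂ ← two (there y∈) =
      z₁ , z₂ , z₁≢z₂ , into z₁∈ s₁ , into z₂∈ s₂ , s₁ , s₂

  ∣p∣≡1⇒≡ : ∣ p ∣ ≡ 1 → x ∈ p → y ∈ p → x ≡ y
  ∣p∣≡1⇒≡ {x = x} {y = y} ∣p∣≡1 x∈ y∈ with x ≟ y
  ... | yes x≡y = x≡y
  ... | no x≢y = ⊥-elim (∣p∣≡0⇒Empty (ℕ.suc-injective (trans (sym (∣p∣≡1+∣p-x∣ x∈)) ∣p∣≡1))
                          (y , x∈p∧x≢y⇒x∈p-y y∈ (x≢y ∘ sym)))

  1<∣p∣⇒∃≢ : 1 < ∣ p ∣ → (x : Fin n) → ∃[ y ] (y ∈ p × y ≢ x)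
  1<∣p∣⇒∃≢ {p = p} 1<∣p∣ x with x ∈? p
  ... | yes x∈ = let y , y∈ = 0<∣p∣⇒Nonempty (s≤s⁻¹ (subst (1 <_) (∣p∣≡1+∣p-x∣ x∈) 1<∣p∣)) in y , x∈p-y⁻ y∈
  ... | no x∉ = let y , y∈ = 0<∣p∣⇒Nonempty (ℕ.<-trans (s≤s z≤n) 1<∣p∣) in y , y∈ , λ { refl → x∉ y∈ }

  ∣p∣≡2+∣p-x-y∣ : x ∈ p → y ∈ p → x ≢ y → ∣ p ∣ ≡ 2 + ∣ p - x - y ∣
  ∣p∣≡2+∣p-x-y∣ x∈ y∈ x≢y = trans (∣p∣≡1+∣p-x∣ x∈) (cong suc (∣p∣≡1+∣p-x∣ (x∈p∧x≢y⇒x∈p-y y∈ (x≢y ∘ sym))))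

  ∣p∣≤2⇒pair : ∣ p ∣ ≤ 2 → x ∈ p → y ∈ p → x ≢ y → ∀ {z} → z ∈ p → z ≡ x ⊎ z ≡ y
  ∣p∣≤2⇒pair {p = p} {x = x} {y = y} ∣p∣≤2 x∈ y∈ x≢y {z} z∈ with z ≟ x | z ≟ y
  ... | yes z≡x | _ = inj₁ z≡x
  ... | no _ | yes z≡y = inj₂ z≡y
  ... | no z≢x | no z≢y = ⊥-elim (∣p∣≡0⇒Empty ∣p-x-y∣≡0 (z , x∈p∧x≢y⇒x∈p-y (x∈p∧x≢y⇒x∈p-y z∈ z≢x) z≢y))
    where
    ∣p-x-y∣≡0 : ∣ p - x - y ∣ ≡ 0
    ∣p-x-y∣≡0 = ℕ.n≤0⇒n≡0 (s≤s⁻¹ (s≤s⁻¹ (subst (_≤ 2) (∣p∣≡2+∣p-x-y∣ x∈ y∈ x≢y) ∣p∣≤2)))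

  ∣p∣≤2⇒≡ : ∣ p ∣ ≤ 2 → x ∈ p → y ∈ p → ∀ {z} → z ∈ p → y ≢ x → z ≢ x → z ≡ y
  ∣p∣≤2⇒≡ ∣p∣≤2 x∈ y∈ z∈ y≢x z≢x with ∣p∣≤2⇒pair ∣p∣≤2 x∈ y∈ (y≢x ∘ sym) z∈
  ... | inj₁ z≡x = ⊥-elim (z≢x z≡x)
  ... | inj₂ z≡y = z≡y

  image : (Fin m → Fin n) → Subset n
  image f = tabulate (does ∘ λ x → any? λ i → f i ≟ x)

  f∈image : (f : Fin m → Fin n) (i : Fin m) → f i ∈ image f
  f∈image f i = x∈tabulate⁺ (λ x → any? λ j → f j ≟ x) (i , refl)

  ∈image⁻ : (f : Fin m → Fin n) → x ∈ image f → ∃[ i ] f i ≡ x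
  ∈image⁻ f = x∈tabulate⁻ (λ x → any? λ j → f j ≟ x)

  ∣image∣≡ : (f : Fin m → Fin n) → Injective _≡_ _≡_ f → ∣ image f ∣ ≡ m
  ∣image∣≡ {zero} f _ = Empty⇒∣p∣≡0 λ (x , x∈) → case ∈image⁻ f x∈ of λ ()
  ∣image∣≡ {suc m} f f-inj = begin
    ∣ image f ∣                ≡⟨ ∣p∣≡1+∣p-x∣ (f∈image f zero) ⟩
    suc ∣ image f - f zero ∣   ≡⟨ cong (suc ∘ ∣_∣) (⊆-antisym ⊆-tail ⊇-tail) ⟩
    suc ∣ image (f ∘ suc) ∣    ≡⟨ cong suc (∣image∣≡ (f ∘ suc) (suc-injective ∘ f-inj)) ⟩
    suc m                      ∎
    where
    open ≡-Reasoning
    ⊆-tail : image f - f zero ⊆ image (f ∘ suc)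
    ⊆-tail x∈ with x∈p-y⁻ x∈
    ... | x∈f , x≢f0 with ∈image⁻ f x∈f
    ...   | zero , refl = ⊥-elim (x≢f0 refl)
    ...   | suc i , refl = f∈image (f ∘ suc) i
    ⊇-tail : image (f ∘ suc) ⊆ image f - f zero
    ⊇-tail x∈ with ∈image⁻ (f ∘ suc) x∈
    ... | i , refl = x∈p∧x≢y⇒x∈p-y (f∈image f (suc i)) (0≢1+n ∘ sym ∘ f-inj)

  x∈p△q⁺ˡ : x ∈ p → x ∉ q → x ∈ p △ q
  x∈p△q⁺ˡ x∈p x∉q = x∈p∪q⁺ (inj₁ (x∈p∧x∉q⇒x∈p─q x∈p x∉q))

  x∈p△q⁺ʳ : x ∉ p → x ∈ q → x ∈ p △ q
  x∈p△q⁺ʳ x∉p x∈q = x∈p∪q⁺ (inj₂ (x∈p∧x∉q⇒x∈p─q x∈q x∉p))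

  x∈p△q⁻ : ∀ (p q : Subset n) → x ∈ p △ q → (x ∈ p × x ∉ q) ⊎ (x ∈ q × x ∉ p)
  x∈p△q⁻ p q x∈ with x∈p∪q⁻ (p ─ q) (q ─ p) x∈
  ... | inj₁ x∈p─q = inj₁ (x∈p─q⁻ p q x∈p─q)
  ... | inj₂ x∈q─p = inj₂ (x∈p─q⁻ q p x∈q─p)

open Subsets

module Incidence {q : ℕ} (Π : ProjectivePlane q) where

  open ProjectivePlane Π

  private variable
    P Q Z : Point
    ℓ m : Line

  lines-coincide : P ≢ Q → P ∈ L ℓ → Q ∈ L ℓ → P ∈ L m → Q ∈ L m → ℓ ≡ m
  lines-coincide P≢Q = join-uniq _ _ P≢Q _ _

  points-coincide : ℓ ≢ m → P ∈ L ℓ → P ∈ L m → Q ∈ L ℓ → Q ∈ L m → P ≡ Q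
  points-coincide ℓ≢m = meet-uniq _ _ ℓ≢m _ _

  ∈∉⇒≢ : P ∈ L ℓ → Q ∉ L ℓ → P ≢ Q
  ∈∉⇒≢ P∈ Q∉ refl = Q∉ P∈

  ∈∉⇒lines≢ : P ∈ L ℓ → P ∉ L m → ℓ ≢ m
  ∈∉⇒lines≢ P∈ P∉ refl = P∉ P∈

  off-other-line : ℓ ≢ m → Z ∈ L ℓ → Z ∈ L m → P ∈ L m → P ≢ Z → P ∉ L ℓ
  off-other-line ℓ≢m Z∈ℓ Z∈m P∈m P≢Z P∈ℓ = P≢Z (points-coincide ℓ≢m P∈ℓ P∈m Z∈ℓ Z∈m)

  -- Total versions of join and meet; the values P ∨ P and ℓ ∧ ℓ are junk.
  _∨_ : Point → Point → Line
  P ∨ Q with P ≟ Q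
  ... | yes _ = P
  ... | no P≢Q = proj₁ (join P Q P≢Q)

  _∧_ : Line → Line → Point
  ℓ ∧ m with ℓ ≟ m
  ... | yes _ = ℓ
  ... | no ℓ≢m = proj₁ (meet ℓ m ℓ≢m)

  ∨-incidentˡ : P ≢ Q → P ∈ L (P ∨ Q)
  ∨-incidentˡ {P} {Q} P≢Q with P ≟ Q
  ... | yes P≡Q = contradiction P≡Q P≢Q
  ... | no P≢Q = proj₁ (proj₂ (join P Q P≢Q))

  ∨-incidentʳ : P ≢ Q → Q ∈ L (P ∨ Q)
  ∨-incidentʳ {P} {Q} P≢Q with P ≟ Q
  ... | yes P≡Q = contradiction P≡Q P≢Q
  ... | no P≢Q = proj₂ (proj₂ (join P Q P≢Q))

  ∧-incidentˡ : ℓ ≢ m → ℓ ∧ m ∈ L ℓ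
  ∧-incidentˡ {ℓ} {m} ℓ≢m with ℓ ≟ m
  ... | yes ℓ≡m = contradiction ℓ≡m ℓ≢m
  ... | no ℓ≢m = proj₁ (proj₂ (meet ℓ m ℓ≢m))

  ∧-incidentʳ : ℓ ≢ m → ℓ ∧ m ∈ L m
  ∧-incidentʳ {ℓ} {m} ℓ≢m with ℓ ≟ m
  ... | yes ℓ≡m = contradiction ℓ≡m ℓ≢m
  ... | no ℓ≢m = proj₂ (proj₂ (meet ℓ m ℓ≢m))

  IsTangent : Subset (numPts q) → Point → Line → Set
  IsTangent S P m = P ∈ L m × P ∈ S × (∀ {Z} → Z ∈ L m → Z ∈ S → Z ≡ P)

  module _ {S : Subset (numPts q)} where

    ∈tangents⁻ : m ∈ tangents Π S P → IsTangent S P m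
    ∈tangents⁻ {m} {P} m∈ = P∈m , P∈S , λ Z∈m Z∈S → x∈⁅y⁆⇒x≡y P (subst (_ ∈_) m∩S≡P (x∈p∩q⁺ (Z∈m , Z∈S)))
      where
      m∩S≡P : L m ∩ S ≡ ⁅ P ⁆
      m∩S≡P = x∈tabulate⁻ (λ ℓ → ≡-dec Bool._≟_ (L ℓ ∩ S) ⁅ P ⁆) m∈
      P∈m∩S : P ∈ L m ∩ S
      P∈m∩S = subst (P ∈_) (sym m∩S≡P) (x∈⁅x⁆ P)
      P∈m : P ∈ L m
      P∈m = proj₁ (x∈p∩q⁻ (L m) S P∈m∩S)
      P∈S : P ∈ S
      P∈S = proj₂ (x∈p∩q⁻ (L m) S P∈m∩S)

    ∈tangents⁺ : IsTangent S P m → m ∈ tangents Π S P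
    ∈tangents⁺ {P} {m} (P∈m , P∈S , only-P) =
      x∈tabulate⁺ (λ ℓ → ≡-dec Bool._≟_ (L ℓ ∩ S) ⁅ P ⁆) (⊆-antisym ⊆⁅P⁆ ⁅P⁆⊆)
      where
      ⊆⁅P⁆ : L m ∩ S ⊆ ⁅ P ⁆
      ⊆⁅P⁆ Z∈ with x∈p∩q⁻ (L m) S Z∈
      ... | Z∈m , Z∈S rewrite only-P Z∈m Z∈S = x∈⁅x⁆ P
      ⁅P⁆⊆ : ⁅ P ⁆ ⊆ L m ∩ S
      ⁅P⁆⊆ Z∈ rewrite x∈⁅y⁆⇒x≡y P Z∈ = x∈p∩q⁺ (P∈m , P∈S)

  lines-through-≤-points-on : P ∉ L ℓ → {M K : Subset (numPts q)} →
    (∀ {m} → m ∈ M → P ∈ L m) → (∀ {m} → m ∈ M → m ∧ ℓ ∈ K) → ∣ M ∣ ≤ ∣ K ∣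
  lines-through-≤-points-on {P} {ℓ} P∉ℓ {M} through into = ∣p∣≤∣q∣-by-injection (_∧ ℓ) into injective
    where
    injective : ∀ {m m′} → m ∈ M → m′ ∈ M → m ∧ ℓ ≡ m′ ∧ ℓ → m ≡ m′
    injective {m} {m′} m∈ m′∈ e = lines-coincide (∈∉⇒≢ (∧-incidentʳ m≢ℓ) P∉ℓ ∘ sym)
      (through m∈) (∧-incidentˡ m≢ℓ) (through m′∈) (subst (_∈ L m′) (sym e) (∧-incidentˡ m′≢ℓ))
      where
      m≢ℓ : m ≢ ℓ
      m≢ℓ = ∈∉⇒lines≢ (through m∈) P∉ℓ
      m′≢ℓ : m′ ≢ ℓ
      m′≢ℓ = ∈∉⇒lines≢ (through m′∈) P∉ℓ

  points-on-≤-lines-through : P ∉ L ℓ → {K M : Subset (numPts q)} →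
    (∀ {Z} → Z ∈ K → Z ∈ L ℓ) → (∀ {Z} → Z ∈ K → P ∨ Z ∈ M) → ∣ K ∣ ≤ ∣ M ∣
  points-on-≤-lines-through {P} {ℓ} P∉ℓ {K} on into = ∣p∣≤∣q∣-by-injection (P ∨_) into injective
    where
    injective : ∀ {Z Z′} → Z ∈ K → Z′ ∈ K → P ∨ Z ≡ P ∨ Z′ → Z ≡ Z′
    injective {Z} {Z′} Z∈ Z′∈ e with Z ≟ Z′
    ... | yes Z≡Z′ = Z≡Z′
    ... | no Z≢Z′ = contradiction (subst (P ∈_) (cong L (sym ℓ≡PZ)) (∨-incidentˡ P≢Z)) P∉ℓ
      where
      P≢Z : P ≢ Z
      P≢Z = ∈∉⇒≢ (on Z∈) P∉ℓ ∘ sym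
      P≢Z′ : P ≢ Z′
      P≢Z′ = ∈∉⇒≢ (on Z′∈) P∉ℓ ∘ sym
      ℓ≡PZ : ℓ ≡ P ∨ Z
      ℓ≡PZ = lines-coincide Z≢Z′ (on Z∈) (on Z′∈) (∨-incidentʳ P≢Z) (subst (Z′ ∈_) (cong L (sym e)) (∨-incidentʳ P≢Z′))

  ∣ℓ─m∣≡q : ℓ ≢ m → ∣ L ℓ ─ L m ∣ ≡ q
  ∣ℓ─m∣≡q {ℓ} {m} ℓ≢m = ℕ.suc-injective (begin
    suc ∣ L ℓ ─ L m ∣  ≡⟨ cong (suc ∘ ∣_∣) (⊆-antisym ⊆-ℓ-O ⊇-ℓ-O) ⟩
    suc ∣ L ℓ - O ∣    ≡⟨ ∣p∣≡1+∣p-x∣ O∈ℓ ⟨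
    ∣ L ℓ ∣            ≡⟨ line-size ℓ ⟩
    suc q              ∎)
    where
    open ≡-Reasoning
    O : Point
    O = ℓ ∧ m
    O∈ℓ : O ∈ L ℓ
    O∈m : O ∈ L m
    O∈ℓ = ∧-incidentˡ ℓ≢m
    O∈m = ∧-incidentʳ ℓ≢m
    ⊆-ℓ-O : L ℓ ─ L m ⊆ L ℓ - O
    ⊆-ℓ-O P∈ with x∈p─q⁻ (L ℓ) (L m) P∈
    ... | P∈ℓ , P∉m = x∈p∧x≢y⇒x∈p-y P∈ℓ λ { refl → P∉m O∈m }
    ⊇-ℓ-O : L ℓ - O ⊆ L ℓ ─ L m
    ⊇-ℓ-O P∈ with x∈p-y⁻ P∈
    ... | P∈ℓ , P≢O = x∈p∧x∉q⇒x∈p─q P∈ℓ λ P∈m → P≢O (points-coincide ℓ≢m P∈ℓ P∈m O∈ℓ O∈m)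

module FanoPlane where

  FanoPoint FanoLine : Set
  FanoPoint = Fin 7
  FanoLine  = Fin 7

  pattern a = zero
  pattern b = suc zero
  pattern c = suc (suc zero)
  pattern d = suc (suc (suc zero))
  pattern ab∧cd = suc (suc (suc (suc zero)))
  pattern ac∧bd = suc (suc (suc (suc (suc zero))))
  pattern ad∧bc = suc (suc (suc (suc (suc (suc zero)))))

  pattern ab = zero
  pattern cd = suc zero
  pattern ac = suc (suc zero)
  pattern bd = suc (suc (suc zero))
  pattern ad = suc (suc (suc (suc zero)))
  pattern bc = suc (suc (suc (suc (suc zero))))
  pattern diagonal = suc (suc (suc (suc (suc (suc zero)))))

  pointsOn : FanoLine → Vec FanoPoint 3
  pointsOn ab = a ∷ b ∷ ab∧cd ∷ []
  pointsOn cd = c ∷ d ∷ ab∧cd ∷ []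
  pointsOn ac = a ∷ c ∷ ac∧bd ∷ []
  pointsOn bd = b ∷ d ∷ ac∧bd ∷ []
  pointsOn ad = a ∷ d ∷ ad∧bc ∷ []
  pointsOn bc = b ∷ c ∷ ad∧bc ∷ []
  pointsOn diagonal = ab∧cd ∷ ac∧bd ∷ ad∧bc ∷ []

  pointsOff : FanoLine → Vec FanoPoint 4
  pointsOff ab = c ∷ d ∷ ac∧bd ∷ ad∧bc ∷ []
  pointsOff cd = a ∷ b ∷ ac∧bd ∷ ad∧bc ∷ []
  pointsOff ac = b ∷ d ∷ ab∧cd ∷ ad∧bc ∷ []
  pointsOff bd = a ∷ c ∷ ab∧cd ∷ ad∧bc ∷ []
  pointsOff ad = b ∷ c ∷ ab∧cd ∷ ac∧bd ∷ []
  pointsOff bc = a ∷ d ∷ ab∧cd ∷ ac∧bd ∷ []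
  pointsOff diagonal = a ∷ b ∷ c ∷ d ∷ []

  infix 4 _∈ₗ_
  _∈ₗ_ : FanoPoint → FanoLine → Set
  i ∈ₗ k = i ∈ᵥ pointsOn k

  triangle : Vec FanoLine 3
  triangle = ab ∷ cd ∷ ac ∷ []

  Separates : FanoLine → FanoPoint → FanoPoint → Set
  Separates k i j = i ∈ₗ k × j ∈ᵥ pointsOff k

  FanoCollinear : FanoPoint → FanoPoint → FanoPoint → Set
  FanoCollinear i j m = ∃[ k ] (i ∈ₗ k × j ∈ₗ k × m ∈ₗ k)

  -- Proved by running the decision procedures; opaque, so that no use site unfolds them.
  opaque

    fano-join : ∀ i j → ∃[ k ] (i ∈ₗ k × j ∈ₗ k)
    fano-join = toWitness {a? = all? λ i → all? λ j → any? λ k → i ∈ᵥ? pointsOn k ×-dec j ∈ᵥ? pointsOn k} _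

    fano-meet : ∀ k m → ∃[ i ] (i ∈ₗ k × i ∈ₗ m)
    fano-meet = toWitness {a? = all? λ k → all? λ m → any? λ i → i ∈ᵥ? pointsOn k ×-dec i ∈ᵥ? pointsOn m} _

    on-or-off : ∀ i k → i ∈ₗ k ⊎ i ∈ᵥ pointsOff k
    on-or-off = toWitness {a? = all? λ i → all? λ k → i ∈ᵥ? pointsOn k ⊎-dec i ∈ᵥ? pointsOff k} _

    ¬on-and-off : ∀ i k → ¬ (i ∈ₗ k × i ∈ᵥ pointsOff k)
    ¬on-and-off = toWitness {a? = all? λ i → all? λ k → ¬? (i ∈ᵥ? pointsOn k ×-dec i ∈ᵥ? pointsOff k)} _

    pointsOn-injective : ∀ k → Injective _≡_ _≡_ (lookup (pointsOn k))
    pointsOn-injective k {x} {y} = toWitness {a? = all? λ k → all? λ x → all? λ y →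
      lookup (pointsOn k) x ≟ lookup (pointsOn k) y →-dec x ≟ y} _ k x y

    triangle-separates : ∀ i j → i ≢ j → ∃[ k ] (k ∈ᵥ triangle × (Separates k i j ⊎ Separates k j i))
    triangle-separates = toWitness {a? = all? λ i → all? λ j → ¬? (i ≟ j) →-dec any? λ k → k ∈ᵥ? triangle ×-dec
      ((i ∈ᵥ? pointsOn k ×-dec j ∈ᵥ? pointsOff k) ⊎-dec (j ∈ᵥ? pointsOn k ×-dec i ∈ᵥ? pointsOff k))} _

    abcd-quadrangle : ¬ FanoCollinear a b c × ¬ FanoCollinear a b d × ¬ FanoCollinear a c d × ¬ FanoCollinear b c d
    abcd-quadrangle = toWitness {a? = ¬? (collinear? a b c) ×-dec ¬? (collinear? a b d) ×-dec
                                      ¬? (collinear? a c d) ×-dec ¬? (collinear? b c d)} _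
      where
      collinear? : ∀ i j m → Dec (FanoCollinear i j m)
      collinear? i j m = any? λ k → i ∈ᵥ? pointsOn k ×-dec j ∈ᵥ? pointsOn k ×-dec m ∈ᵥ? pointsOn k

module FanoEmbedding {q : ℕ} (Π : ProjectivePlane q) where

  open FanoPlane
  open ProjectivePlane Π
  open Incidence Π

  Preserves : (FanoPoint → Point) → (FanoLine → Line) → Set
  Preserves f g = ∀ k → All (λ i → f i ∈ L (g k)) (pointsOn k)

  Avoids : (FanoPoint → Point) → (FanoLine → Line) → FanoLine → Set
  Avoids f g k = All (λ i → f i ∉ L (g k)) (pointsOff k)

  module _ (f : FanoPoint → Point) (g : FanoLine → Line) (preserves : Preserves f g)
           (avoids-ab : Avoids f g ab) (avoids-cd : Avoids f g cd) (avoids-ac : Avoids f g ac) where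

    private variable
      i j m : FanoPoint
      k : FanoLine

    incident : i ∈ₗ k → f i ∈ L (g k)
    incident {k = k} = All.lookup (preserves k)

    avoids-triangle : k ∈ᵥ triangle → Avoids f g k
    avoids-triangle (here refl) = avoids-ab
    avoids-triangle (there (here refl)) = avoids-cd
    avoids-triangle (there (there (here refl))) = avoids-ac

    injective : Injective _≡_ _≡_ f
    injective {i} {j} fi≡fj with i ≟ j
    ... | yes i≡j = i≡j
    ... | no i≢j with triangle-separates i j i≢j
    ...   | k , k∈ , inj₁ (i∈k , j∉k) =
              contradiction (subst (_∈ L (g k)) fi≡fj (incident i∈k)) (All.lookup (avoids-triangle k∈) j∉k)
    ...   | k , k∈ , inj₂ (j∈k , i∉k) =
              contradiction (subst (_∈ L (g k)) (sym fi≡fj) (incident j∈k)) (All.lookup (avoids-triangle k∈) i∉k)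

    -- If f i lay on g k with i off k, every line through i would meet k in a point of
    -- g k other than f i, so the whole image would lie on g k = g ab, which misses f c.
    reflects : f i ∈ L (g k) → i ∈ₗ k
    reflects {i} {k} fi∈gk with on-or-off i k
    ... | inj₁ i∈k = i∈k
    ... | inj₂ i∉k = ⊥-elim (All.lookup avoids-ab (here refl) (subst (λ ℓ → f c ∈ L ℓ) gk≡gab (on-gk c)))
      where
      on-gk : ∀ j → f j ∈ L (g k)
      on-gk j with j ≟ i
      ... | yes refl = fi∈gk
      ... | no j≢i with fano-join i j
      ...   | k′ , i∈k′ , j∈k′ with fano-meet k k′
      ...     | h , h∈k , h∈k′ = subst (λ ℓ → f j ∈ L ℓ) (sym gk≡gk′) (incident j∈k′)
        where
        h≢i : h ≢ i
        h≢i refl = ¬on-and-off h k (h∈k , i∉k)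
        gk≡gk′ : g k ≡ g k′
        gk≡gk′ = lines-coincide (h≢i ∘ injective) (incident h∈k) fi∈gk (incident h∈k′) (incident i∈k′)
      gk≡gab : g k ≡ g ab
      gk≡gab = lines-coincide (λ fa≡fb → case injective fa≡fb of λ ())
                 (on-gk a) (on-gk b) (incident (here refl)) (incident (there (here refl)))

    ¬collinear : ¬ FanoCollinear i j m → i ≢ j → ¬ Collinear (f i) (f j) (f m)
    ¬collinear {i} {j} {m} ¬ijm i≢j (ℓ , fi∈ℓ , fj∈ℓ , fm∈ℓ) with fano-join i j
    ... | k , i∈k , j∈k = ¬ijm (k , i∈k , j∈k , reflects (subst (λ ℓ → f m ∈ L ℓ) ℓ≡gk fm∈ℓ))
      where
      ℓ≡gk : ℓ ≡ g k
      ℓ≡gk = lines-coincide (i≢j ∘ injective) fi∈ℓ fj∈ℓ (incident i∈k) (incident j∈k)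

    trace : L (g k) ∩ image f ≡ image (f ∘ lookup (pointsOn k))
    trace {k} = ⊆-antisym ⊆-trace ⊇-trace
      where
      ⊆-trace : L (g k) ∩ image f ⊆ image (f ∘ lookup (pointsOn k))
      ⊆-trace P∈ with x∈p∩q⁻ (L (g k)) (image f) P∈
      ... | P∈gk , P∈f with ∈image⁻ f P∈f
      ...   | i , refl = subst (_∈ image (f ∘ lookup (pointsOn k))) (cong f (sym (lookup-index (reflects P∈gk))))
                             (f∈image (f ∘ lookup (pointsOn k)) (index (reflects P∈gk)))
      ⊇-trace : image (f ∘ lookup (pointsOn k)) ⊆ L (g k) ∩ image f
      ⊇-trace P∈ with ∈image⁻ (f ∘ lookup (pointsOn k)) P∈
      ... | x , refl = x∈p∩q⁺ (incident (∈-lookup x (pointsOn k)) , f∈image f (lookup (pointsOn k) x))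

    isFanoSubplane : IsFanoSubplane Π (image f) (image g)
    isFanoSubplane = joins , meets , quadrangle-image , three-points
      where
      joins : ∀ P Q → P ∈ image f → Q ∈ image f → P ≢ Q → ∃[ ℓ ] (ℓ ∈ image g × P ∈ L ℓ × Q ∈ L ℓ)
      joins P Q P∈ Q∈ _ with ∈image⁻ f P∈ | ∈image⁻ f Q∈
      ... | i , refl | j , refl with fano-join i j
      ...   | k , i∈k , j∈k = g k , f∈image g k , incident i∈k , incident j∈k
      meets : ∀ ℓ ℓ′ → ℓ ∈ image g → ℓ′ ∈ image g → ℓ ≢ ℓ′ → ∃[ P ] (P ∈ image f × P ∈ L ℓ × P ∈ L ℓ′)
      meets ℓ ℓ′ ℓ∈ ℓ′∈ _ with ∈image⁻ g ℓ∈ | ∈image⁻ g ℓ′∈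
      ... | k , refl | k′ , refl with fano-meet k k′
      ...   | i , i∈k , i∈k′ = f i , f∈image f i , incident i∈k , incident i∈k′
      quadrangle-image : ∃[ A ] ∃[ B ] ∃[ C ] ∃[ D ]
        (A ∈ image f × B ∈ image f × C ∈ image f × D ∈ image f ×
         ¬ Collinear A B C × ¬ Collinear A B D × ¬ Collinear A C D × ¬ Collinear B C D)
      quadrangle-image = let (abc , abd , acd , bcd) = abcd-quadrangle in
        f a , f b , f c , f d , f∈image f a , f∈image f b , f∈image f c , f∈image f d ,
        ¬collinear abc (λ ()) , ¬collinear abd (λ ()) , ¬collinear acd (λ ()) , ¬collinear bcd (λ ())
      three-points : ∀ ℓ → ℓ ∈ image g → ∣ L ℓ ∩ image f ∣ ≡ 3
      three-points ℓ ℓ∈ with ∈image⁻ g ℓ∈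
      ... | k , refl = trans (cong ∣_∣ trace) (∣image∣≡ (f ∘ lookup (pointsOn k)) (pointsOn-injective k ∘ injective))

module VcircSemiarc {q : ℕ} (Π : ProjectivePlane q) {t : ℕ} {S : Subset (numPts q)}
  (t<q∸1 : t < q ∸ 1) (semiarc : IsSemiarc Π t S)
  {ℓ₁ ℓ₂ : Fin (numPts q)} (ℓ₁≢ℓ₂ : ℓ₁ ≢ ℓ₂)
  (meet∉S : ∀ X → X ∈ ProjectivePlane.L Π ℓ₁ → X ∈ ProjectivePlane.L Π ℓ₂ → X ∉ S)
  {R₁ R₂ : Subset (numPts q)}
  (R₁⊆ : R₁ ⊆ ProjectivePlane.L Π ℓ₁ ─ ProjectivePlane.L Π ℓ₂) (∣R₁∣≡t : ∣ R₁ ∣ ≡ t)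
  (R₂⊆ : R₂ ⊆ ProjectivePlane.L Π ℓ₂ ─ ProjectivePlane.L Π ℓ₁) (∣R₂∣≡t : ∣ R₂ ∣ ≡ t)
  (S-on-ℓ₁△ℓ₂ : (ProjectivePlane.L Π ℓ₁ △ ProjectivePlane.L Π ℓ₂) ∩ S
               ≡ (ProjectivePlane.L Π ℓ₁ △ ProjectivePlane.L Π ℓ₂) ─ (R₁ ∪ R₂)) where

  open ProjectivePlane Π
  open Incidence Π
  open FanoEmbedding Π using (Preserves; Avoids; isFanoSubplane)
  open FanoPlane using (FanoPoint; FanoLine)
  module F = FanoPlane

  L₁ L₂ : Subset (numPts q)
  L₁ = L ℓ₁
  L₂ = L ℓ₂

  private variable
    P X Y Z Z′ r : Point
    m : Line

  V : Point
  V = ℓ₁ ∧ ℓ₂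

  V∈L₁ : V ∈ L₁
  V∈L₁ = ∧-incidentˡ ℓ₁≢ℓ₂

  V∈L₂ : V ∈ L₂
  V∈L₂ = ∧-incidentʳ ℓ₁≢ℓ₂

  V∉S : V ∉ S
  V∉S = meet∉S V V∈L₁ V∈L₂

  ≡V : X ∈ L₁ → X ∈ L₂ → X ≡ V
  ≡V X∈L₁ X∈L₂ = points-coincide ℓ₁≢ℓ₂ X∈L₁ X∈L₂ V∈L₁ V∈L₂

  R₁⁻ : r ∈ R₁ → r ∈ L₁ × r ∉ L₂
  R₁⁻ r∈ = x∈p─q⁻ L₁ L₂ (R₁⊆ r∈)

  R₂⁻ : r ∈ R₂ → r ∈ L₂ × r ∉ L₁
  R₂⁻ r∈ = x∈p─q⁻ L₂ L₁ (R₂⊆ r∈)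

  ∈S⇔∉R : X ∈ L₁ △ L₂ → (X ∈ S → X ∉ R₁ ∪ R₂) × (X ∉ R₁ ∪ R₂ → X ∈ S)
  ∈S⇔∉R {X} X∈ =
    (λ X∈S → x∈p─q⇒x∉q (L₁ △ L₂) (R₁ ∪ R₂) (subst (X ∈_) S-on-ℓ₁△ℓ₂ (x∈p∩q⁺ (X∈ , X∈S)))) ,
    (λ X∉R → proj₂ (x∈p∩q⁻ (L₁ △ L₂) S (subst (X ∈_) (sym S-on-ℓ₁△ℓ₂) (x∈p∧x∉q⇒x∈p─q X∈ X∉R))))

  R₁∉S : r ∈ R₁ → r ∉ S
  R₁∉S r∈ r∈S = proj₁ (∈S⇔∉R (uncurry x∈p△q⁺ˡ (R₁⁻ r∈))) r∈S (x∈p∪q⁺ (inj₁ r∈))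

  R₂∉S : r ∈ R₂ → r ∉ S
  R₂∉S r∈ r∈S = proj₁ (∈S⇔∉R (x∈p△q⁺ʳ (proj₂ (R₂⁻ r∈)) (proj₁ (R₂⁻ r∈)))) r∈S (x∈p∪q⁺ (inj₂ r∈))

  ∉S⇒∈R₁ : X ∈ L₁ → X ∉ L₂ → X ∉ S → X ∈ R₁
  ∉S⇒∈R₁ {X} X∈L₁ X∉L₂ X∉S with X ∈? R₁
  ... | yes X∈R₁ = X∈R₁
  ... | no X∉R₁ = contradiction (proj₂ (∈S⇔∉R (x∈p△q⁺ˡ X∈L₁ X∉L₂)) X∉R) X∉S
    where
    X∉R : X ∉ R₁ ∪ R₂
    X∉R = [ X∉R₁ , (λ X∈R₂ → proj₂ (R₂⁻ X∈R₂) X∈L₁) ] ∘ x∈p∪q⁻ R₁ R₂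

  ∉S⇒∈R₂ : X ∈ L₂ → X ∉ L₁ → X ∉ S → X ∈ R₂
  ∉S⇒∈R₂ {X} X∈L₂ X∉L₁ X∉S with X ∈? R₂
  ... | yes X∈R₂ = X∈R₂
  ... | no X∉R₂ = contradiction (proj₂ (∈S⇔∉R (x∈p△q⁺ʳ X∉L₁ X∈L₂)) X∉R) X∉S
    where
    X∉R : X ∉ R₁ ∪ R₂
    X∉R = [ (λ X∈R₁ → proj₂ (R₁⁻ X∈R₁) X∈L₂) , X∉R₂ ] ∘ x∈p∪q⁻ R₁ R₂

  T : Subset (numPts q)
  T = S ─ (L₁ ∪ L₂)

  T⊆S : X ∈ T → X ∈ S
  T⊆S = p─q⊆p S (L₁ ∪ L₂)

  T∉L₁ : X ∈ T → X ∉ L₁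
  T∉L₁ X∈T = x∈p─q⇒x∉q S (L₁ ∪ L₂) X∈T ∘ x∈p∪q⁺ ∘ inj₁

  T∉L₂ : X ∈ T → X ∉ L₂
  T∉L₂ X∈T = x∈p─q⇒x∉q S (L₁ ∪ L₂) X∈T ∘ x∈p∪q⁺ ∘ inj₂

  T⁺ : X ∈ S → X ∉ L₁ → X ∉ L₂ → X ∈ T
  T⁺ X∈S X∉L₁ X∉L₂ = x∈p∧x∉q⇒x∈p─q X∈S ([ X∉L₁ , X∉L₂ ] ∘ x∈p∪q⁻ L₁ L₂)

  C : Subset (numPts q)
  C = L₁ ─ S

  C⁻ : Z ∈ C → Z ∈ L₁ × Z ∉ S
  C⁻ = x∈p─q⁻ L₁ S

  R₁⊆C : r ∈ R₁ → r ∈ C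
  R₁⊆C r∈ = x∈p∧x∉q⇒x∈p─q (proj₁ (R₁⁻ r∈)) (R₁∉S r∈)

  V∈C : V ∈ C
  V∈C = x∈p∧x∉q⇒x∈p─q V∈L₁ V∉S

  C≡V∪R₁ : C ≡ ⁅ V ⁆ ∪ R₁
  C≡V∪R₁ = ⊆-antisym ⊆-V∪R₁ ⊇-V∪R₁
    where
    ⊆-V∪R₁ : C ⊆ ⁅ V ⁆ ∪ R₁
    ⊆-V∪R₁ {Z} Z∈C with C⁻ Z∈C | Z ∈? L₂
    ... | Z∈L₁ , _ | yes Z∈L₂ = x∈p∪q⁺ (inj₁ (subst (_∈ ⁅ V ⁆) (sym (≡V Z∈L₁ Z∈L₂)) (x∈⁅x⁆ V)))
    ... | Z∈L₁ , Z∉S | no Z∉L₂ = x∈p∪q⁺ (inj₂ (∉S⇒∈R₁ Z∈L₁ Z∉L₂ Z∉S))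
    ⊇-V∪R₁ : ⁅ V ⁆ ∪ R₁ ⊆ C
    ⊇-V∪R₁ Z∈ with x∈p∪q⁻ ⁅ V ⁆ R₁ Z∈
    ... | inj₁ Z∈V rewrite x∈⁅y⁆⇒x≡y V Z∈V = V∈C
    ... | inj₂ Z∈R₁ = R₁⊆C Z∈R₁

  ∣C∣≡1+t : ∣ C ∣ ≡ suc t
  ∣C∣≡1+t = begin
    ∣ C ∣              ≡⟨ cong ∣_∣ C≡V∪R₁ ⟩
    ∣ ⁅ V ⁆ ∪ R₁ ∣     ≡⟨ ∣p∪q∣≡∣p∣+∣q∣ (λ Z∈V Z∈R₁ → proj₂ (R₁⁻ Z∈R₁) (subst (_∈ L₂) (sym (x∈⁅y⁆⇒x≡y V Z∈V)) V∈L₂)) ⟩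
    ∣ ⁅ V ⁆ ∣ + ∣ R₁ ∣ ≡⟨ cong₂ _+_ (∣⁅x⁆∣≡1 V) ∣R₁∣≡t ⟩
    suc t              ∎
    where open ≡-Reasoning

  2+t≤q : 2 + t ≤ q
  2+t≤q = 2+t≤ q t<q∸1
    where
    2+t≤ : ∀ n → t < n ∸ 1 → 2 + t ≤ n
    2+t≤ (suc n) t<n = s≤s t<n

  other-point-on-ℓ₂ : ∀ P → ∃[ Q ] (Q ∈ S × Q ∈ L₂ × Q ≢ P)
  other-point-on-ℓ₂ P =
    let Q , Q∈A₂ , Q≢P = 1<∣p∣⇒∃≢ 1<∣A₂∣ P in Q , A₂⊆S Q∈A₂ , A₂⊆L₂ Q∈A₂ , Q≢P
    where
    A₂ : Subset (numPts q)
    A₂ = (L₂ ─ L₁) ─ R₂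
    A₂⊆L₂ : A₂ ⊆ L₂
    A₂⊆L₂ = p─q⊆p L₂ L₁ ∘ p─q⊆p (L₂ ─ L₁) R₂
    A₂⊆S : A₂ ⊆ S
    A₂⊆S {Q} Q∈A₂ with Q ∈? S | x∈p─q⁻ (L₂ ─ L₁) R₂ Q∈A₂
    ... | yes Q∈S | _ = Q∈S
    ... | no Q∉S | Q∈L₂─L₁ , Q∉R₂ =
      contradiction (uncurry ∉S⇒∈R₂ (x∈p─q⁻ L₂ L₁ Q∈L₂─L₁) Q∉S) Q∉R₂
    q≡t+∣A₂∣ : q ≡ t + ∣ A₂ ∣
    q≡t+∣A₂∣ = trans (sym (∣ℓ─m∣≡q (ℓ₁≢ℓ₂ ∘ sym))) (trans (∣q∣≡∣p∣+∣q─p∣ R₂⊆) (cong (_+ ∣ A₂ ∣) ∣R₂∣≡t))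
    1<∣A₂∣ : 1 < ∣ A₂ ∣
    1<∣A₂∣ = ℕ.+-cancelˡ-≤ t 2 ∣ A₂ ∣ (subst₂ _≤_ (ℕ.+-comm 2 t) q≡t+∣A₂∣ 2+t≤q)

  ∣tangents∣≡t : P ∈ S → ∣ tangents Π S P ∣ ≡ t
  ∣tangents∣≡t = proj₂ semiarc _

  t≤∣trace-of-tangents∣ : {K : Subset (numPts q)} {ℓ : Line} → P ∈ S → P ∉ L ℓ →
    (∀ {m} → IsTangent S P m → m ∧ ℓ ∈ K) → t ≤ ∣ K ∣
  t≤∣trace-of-tangents∣ P∈S P∉ℓ into = subst (_≤ _) (∣tangents∣≡t P∈S)
    (lines-through-≤-points-on P∉ℓ (proj₁ ∘ ∈tangents⁻) (into ∘ ∈tangents⁻))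

  ∈S∩L₂⇒∉L₁ : P ∈ S → P ∈ L₂ → P ∉ L₁
  ∈S∩L₂⇒∉L₁ {P} P∈S P∈L₂ P∈L₁ = meet∉S P P∈L₁ P∈L₂ P∈S

  tangent-meets-ℓ₁-in-R₁ : P ∈ S → P ∈ L₂ → IsTangent S P m → m ∧ ℓ₁ ∈ R₁
  tangent-meets-ℓ₁-in-R₁ {P} {m} P∈S P∈L₂ (P∈m , _ , only-P) = ∉S⇒∈R₁ Y∈L₁ Y∉L₂ Y∉S
    where
    P∉L₁ : P ∉ L₁
    P∉L₁ = ∈S∩L₂⇒∉L₁ P∈S P∈L₂
    m≢ℓ₁ : m ≢ ℓ₁
    m≢ℓ₁ = ∈∉⇒lines≢ P∈m P∉L₁
    Y∈m : m ∧ ℓ₁ ∈ L m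
    Y∈m = ∧-incidentˡ m≢ℓ₁
    Y∈L₁ : m ∧ ℓ₁ ∈ L₁
    Y∈L₁ = ∧-incidentʳ m≢ℓ₁
    Y∉S : m ∧ ℓ₁ ∉ S
    Y∉S Y∈S = P∉L₁ (subst (_∈ L₁) (only-P Y∈m Y∈S) Y∈L₁)
    Y∉L₂ : m ∧ ℓ₁ ∉ L₂
    Y∉L₂ Y∈L₂ =
      let Q , Q∈S , Q∈L₂ , Q≢P = other-point-on-ℓ₂ P
          m≡ℓ₂ = lines-coincide (∈∉⇒≢ Y∈L₁ P∉L₁) Y∈m P∈m Y∈L₂ P∈L₂
      in Q≢P (only-P (subst (λ ℓ → Q ∈ L ℓ) (sym m≡ℓ₂) Q∈L₂) Q∈S)

  -- Otherwise the t tangents at P would meet ℓ₁ in the t − 1 points of R₁ other than r.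
  R₁-line-is-tangent : P ∈ S → P ∈ L₂ → r ∈ R₁ → P ∈ L m → r ∈ L m → IsTangent S P m
  R₁-line-is-tangent {P} {r} {m} P∈S P∈L₂ r∈R₁ P∈m r∈m = P∈m , P∈S , only-P
    where
    only-P : Z ∈ L m → Z ∈ S → Z ≡ P
    only-P {Z} Z∈m Z∈S with Z ≟ P
    ... | yes Z≡P = Z≡P
    ... | no Z≢P = contradiction t≤∣R₁-r∣ (ℕ.<⇒≱ (subst (∣ R₁ - r ∣ <_) ∣R₁∣≡t (x∈p⇒∣p-x∣<∣p∣ r∈R₁)))
      where
      avoids-r : ∀ {m′} → IsTangent S P m′ → m′ ∧ ℓ₁ ∈ R₁ - r
      avoids-r {m′} tangent@(P∈m′ , _ , only-P′) = x∈p∧x≢y⇒x∈p-y (tangent-meets-ℓ₁-in-R₁ P∈S P∈L₂ tangent) λ Y≡r →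
        let m′≢ℓ₁ = ∈∉⇒lines≢ P∈m′ (∈S∩L₂⇒∉L₁ P∈S P∈L₂)
            m′≡m = lines-coincide (∈∉⇒≢ P∈L₂ (proj₂ (R₁⁻ r∈R₁))) P∈m′ (subst (_∈ L m′) Y≡r (∧-incidentˡ m′≢ℓ₁)) P∈m r∈m
        in Z≢P (only-P′ (subst (λ ℓ → Z ∈ L ℓ) (sym m′≡m) Z∈m) Z∈S)
      t≤∣R₁-r∣ : t ≤ ∣ R₁ - r ∣
      t≤∣R₁-r∣ = t≤∣trace-of-tangents∣ P∈S (∈S∩L₂⇒∉L₁ P∈S P∈L₂) avoids-r

  T-R₁-line-meets-ℓ₂-in-R₂ : X ∈ T → r ∈ R₁ → X ∈ L m → r ∈ L m → Y ∈ L m → Y ∈ L₂ → Y ∈ R₂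
  T-R₁-line-meets-ℓ₂-in-R₂ {X} {r} {m} {Y} X∈T r∈R₁ X∈m r∈m Y∈m Y∈L₂ = ∉S⇒∈R₂ Y∈L₂ Y∉L₁ Y∉S
    where
    Y∉L₁ : Y ∉ L₁
    Y∉L₁ Y∈L₁ = T∉L₁ X∈T (subst (λ ℓ → X ∈ L ℓ) m≡ℓ₁ X∈m)
      where
      m≡ℓ₁ : m ≡ ℓ₁
      m≡ℓ₁ = lines-coincide (∈∉⇒≢ Y∈L₂ (proj₂ (R₁⁻ r∈R₁))) Y∈m r∈m Y∈L₁ (proj₁ (R₁⁻ r∈R₁))
    Y∉S : Y ∉ S
    Y∉S Y∈S = T∉L₂ X∈T (subst (_∈ L₂) (sym (only-Y X∈m (T⊆S X∈T))) Y∈L₂)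
      where
      only-Y : ∀ {W} → W ∈ L m → W ∈ S → W ≡ Y
      only-Y = proj₂ (proj₂ (R₁-line-is-tangent Y∈S Y∈L₂ r∈R₁ Y∈m r∈m))

  T≢C : X ∈ T → Z ∈ C → X ≢ Z
  T≢C X∈T Z∈C = ∈∉⇒≢ (proj₁ (C⁻ Z∈C)) (T∉L₁ X∈T) ∘ sym

  Secant : Point → Point → Set
  Secant X Z = ∃[ W ] (W ∈ S × W ≢ X × W ∈ L (X ∨ Z))

  secant? : ∀ X Z → Dec (Secant X Z)
  secant? X Z = any? λ W → W ∈? S ×-dec ¬? (W ≟ X) ×-dec W ∈? L (X ∨ Z)

  ¬secant⇒tangent : X ∈ T → Z ∈ C → ¬ Secant X Z → IsTangent S X (X ∨ Z)
  ¬secant⇒tangent {X} {Z} X∈T Z∈C ¬secant = ∨-incidentˡ (T≢C X∈T Z∈C) , T⊆S X∈T , only-X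
    where
    only-X : ∀ {W} → W ∈ L (X ∨ Z) → W ∈ S → W ≡ X
    only-X {W} W∈XZ W∈S with W ≟ X
    ... | yes W≡X = W≡X
    ... | no W≢X = contradiction (W , W∈S , W≢X , W∈XZ) ¬secant

  tangent-misses-secant-point : X ∈ T → Z ∈ C → Secant X Z → IsTangent S X m → Z ∉ L m
  tangent-misses-secant-point {X} {Z} {m} X∈T Z∈C (W , W∈S , W≢X , W∈XZ) (X∈m , _ , only-X) Z∈m =
    W≢X (only-X (subst (λ ℓ → W ∈ L ℓ) XZ≡m W∈XZ) W∈S)
    where
    X≢Z : X ≢ Z
    X≢Z = T≢C X∈T Z∈C
    XZ≡m : X ∨ Z ≡ m
    XZ≡m = lines-coincide X≢Z (∨-incidentˡ X≢Z) (∨-incidentʳ X≢Z) X∈m Z∈m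

  tangent-meets-ℓ₁-in-C : X ∈ T → IsTangent S X m → m ∧ ℓ₁ ∈ C × m ∧ ℓ₁ ∈ L m
  tangent-meets-ℓ₁-in-C {X} {m} X∈T (X∈m , _ , only-X) = x∈p∧x∉q⇒x∈p─q Y∈L₁ Y∉S , ∧-incidentˡ m≢ℓ₁
    where
    m≢ℓ₁ : m ≢ ℓ₁
    m≢ℓ₁ = ∈∉⇒lines≢ X∈m (T∉L₁ X∈T)
    Y∈L₁ : m ∧ ℓ₁ ∈ L₁
    Y∈L₁ = ∧-incidentʳ m≢ℓ₁
    Y∉S : m ∧ ℓ₁ ∉ S
    Y∉S Y∈S = T∉L₁ X∈T (subst (_∈ L₁) (only-X (∧-incidentˡ m≢ℓ₁) Y∈S) Y∈L₁)

  -- Otherwise the t + 1 lines joining X to C would all be tangents.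
  secant-exists : X ∈ T → ∃[ Z ] (Z ∈ C × Secant X Z)
  secant-exists {X} X∈T with any? (λ Z → Z ∈? C ×-dec secant? X Z)
  ... | yes secant = secant
  ... | no ∄secant = ⊥-elim (ℕ.n≮n t (subst (_≤ t) ∣C∣≡1+t ∣C∣≤t))
    where
    ∣C∣≤t : ∣ C ∣ ≤ t
    ∣C∣≤t = subst (∣ C ∣ ≤_) (∣tangents∣≡t (T⊆S X∈T)) (points-on-≤-lines-through (T∉L₁ X∈T) (proj₁ ∘ C⁻)
      λ Z∈C → ∈tangents⁺ (¬secant⇒tangent X∈T Z∈C λ secant → ∄secant (_ , Z∈C , secant)))

  -- Otherwise the t tangents at X would meet ℓ₁ in the t − 1 points of C other than Z, Z′.
  secant-unique : X ∈ T → Z ∈ C → Z′ ∈ C → Secant X Z → Secant X Z′ → Z ≡ Z′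
  secant-unique {X} {Z} {Z′} X∈T Z∈C Z′∈C secant secant′ with Z ≟ Z′
  ... | yes Z≡Z′ = Z≡Z′
  ... | no Z≢Z′ = ⊥-elim (ℕ.n≮n _ (subst (_≤ ∣ C - Z - Z′ ∣) (ℕ.suc-injective ∣C∣≡2+k) t≤k))
    where
    ∣C∣≡2+k : suc t ≡ suc (suc ∣ C - Z - Z′ ∣)
    ∣C∣≡2+k = trans (sym ∣C∣≡1+t) (∣p∣≡2+∣p-x-y∣ Z∈C Z′∈C Z≢Z′)
    into : ∀ {m} → IsTangent S X m → m ∧ ℓ₁ ∈ C - Z - Z′
    into tangent with tangent-meets-ℓ₁-in-C X∈T tangent
    ... | Y∈C , Y∈m = x∈p∧x≢y⇒x∈p-y (x∈p∧x≢y⇒x∈p-y Y∈C λ { refl → tangent-misses-secant-point X∈T Z∈C secant tangent Y∈m })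
                                    λ { refl → tangent-misses-secant-point X∈T Z′∈C secant′ tangent Y∈m }
    t≤k : t ≤ ∣ C - Z - Z′ ∣
    t≤k = t≤∣trace-of-tangents∣ (T⊆S X∈T) (T∉L₁ X∈T) into

  secant-point-in-T : X ∈ T → Z ∈ C → Y ∈ S → Y ≢ X → Y ∈ L (X ∨ Z) → Y ∈ T
  secant-point-in-T {X} {Z} {Y} X∈T Z∈C Y∈S Y≢X Y∈XZ = T⁺ Y∈S Y∉L₁ Y∉L₂
    where
    X≢Z : X ≢ Z
    X≢Z = T≢C X∈T Z∈C
    Z∈L₁ : Z ∈ L₁
    Z∈L₁ = proj₁ (C⁻ Z∈C)
    Z∉S : Z ∉ S
    Z∉S = proj₂ (C⁻ Z∈C)
    Z≡ : ∀ {ℓ} → X ∉ L ℓ → Y ∈ L ℓ → Z ∈ L ℓ → Y ≡ Z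
    Z≡ X∉ℓ Y∈ℓ Z∈ℓ = points-coincide (∈∉⇒lines≢ (∨-incidentˡ X≢Z) X∉ℓ) Y∈XZ Y∈ℓ (∨-incidentʳ X≢Z) Z∈ℓ
    Y∉L₁ : Y ∉ L₁
    Y∉L₁ Y∈L₁ = Z∉S (subst (_∈ S) (Z≡ (T∉L₁ X∈T) Y∈L₁ Z∈L₁) Y∈S)
    Y∉L₂ : Y ∉ L₂
    Y∉L₂ Y∈L₂ with Z ∈? L₂
    ... | yes Z∈L₂ = Z∉S (subst (_∈ S) (Z≡ (T∉L₂ X∈T) Y∈L₂ Z∈L₂) Y∈S)
    ... | no Z∉L₂ = R₂∉S (T-R₁-line-meets-ℓ₂-in-R₂ X∈T (∉S⇒∈R₁ Z∈L₁ Z∉L₂ Z∉S)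
                           (∨-incidentˡ X≢Z) (∨-incidentʳ X≢Z) Y∈XZ Y∈L₂) Y∈S

  Sℓ : Subset (numPts q)
  Sℓ = (L₁ △ L₂) ∩ S

  S─Sℓ≡T : S ─ Sℓ ≡ T
  S─Sℓ≡T = ⊆-antisym ⊆-T ⊇-T
    where
    ⊆-T : S ─ Sℓ ⊆ T
    ⊆-T {X} X∈ with x∈p─q⁻ S Sℓ X∈
    ... | X∈S , X∉Sℓ = T⁺ X∈S X∉L₁ X∉L₂
      where
      X∉L₁ : X ∉ L₁
      X∉L₁ X∈L₁ = X∉Sℓ (x∈p∩q⁺ (x∈p△q⁺ˡ X∈L₁ (λ X∈L₂ → meet∉S X X∈L₁ X∈L₂ X∈S) , X∈S))
      X∉L₂ : X ∉ L₂
      X∉L₂ X∈L₂ = X∉Sℓ (x∈p∩q⁺ (x∈p△q⁺ʳ (λ X∈L₁ → meet∉S X X∈L₁ X∈L₂ X∈S) X∈L₂ , X∈S))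
    ⊇-T : T ⊆ S ─ Sℓ
    ⊇-T {X} X∈T = x∈p∧x∉q⇒x∈p─q (T⊆S X∈T) λ X∈Sℓ → case x∈p△q⁻ L₁ L₂ (proj₁ (x∈p∩q⁻ _ S X∈Sℓ)) of λ where
      (inj₁ (X∈L₁ , _)) → T∉L₁ X∈T X∈L₁
      (inj₂ (X∈L₂ , _)) → T∉L₂ X∈T X∈L₂

  ∣S∣≡∣Sℓ∣+∣T∣ : ∣ S ∣ ≡ ∣ Sℓ ∣ + ∣ T ∣
  ∣S∣≡∣Sℓ∣+∣T∣ = trans (∣q∣≡∣p∣+∣q─p∣ (p∩q⊆q _ S)) (cong (λ p → ∣ Sℓ ∣ + ∣ p ∣) S─Sℓ≡T)

  2q≡t+[t+∣Sℓ∣] : 2 * q ≡ t + (t + ∣ Sℓ ∣)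
  2q≡t+[t+∣Sℓ∣] = begin
    2 * q                                      ≡⟨ cong (q +_) (ℕ.+-identityʳ q) ⟩
    q + q                                      ≡⟨ cong₂ _+_ (∣ℓ─m∣≡q ℓ₁≢ℓ₂) (∣ℓ─m∣≡q (ℓ₁≢ℓ₂ ∘ sym)) ⟨
    ∣ L₁ ─ L₂ ∣ + ∣ L₂ ─ L₁ ∣                  ≡⟨ ∣p∪q∣≡∣p∣+∣q∣ (λ X∈ X∈′ → x∈p─q⇒x∉q L₂ L₁ X∈′ (p─q⊆p L₁ L₂ X∈)) ⟨
    ∣ L₁ △ L₂ ∣                                ≡⟨ ∣q∣≡∣p∣+∣q─p∣ R⊆L₁△L₂ ⟩
    ∣ R₁ ∪ R₂ ∣ + ∣ (L₁ △ L₂) ─ (R₁ ∪ R₂) ∣    ≡⟨ cong₂ _+_ ∣R₁∪R₂∣≡t+t (cong ∣_∣ (sym S-on-ℓ₁△ℓ₂)) ⟩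
    (t + t) + ∣ Sℓ ∣                            ≡⟨ ℕ.+-assoc t t _ ⟩
    t + (t + ∣ Sℓ ∣)                            ∎
    where
    open ≡-Reasoning
    R⊆L₁△L₂ : R₁ ∪ R₂ ⊆ L₁ △ L₂
    R⊆L₁△L₂ r∈ with x∈p∪q⁻ R₁ R₂ r∈
    ... | inj₁ r∈R₁ = uncurry x∈p△q⁺ˡ (R₁⁻ r∈R₁)
    ... | inj₂ r∈R₂ = x∈p△q⁺ʳ (proj₂ (R₂⁻ r∈R₂)) (proj₁ (R₂⁻ r∈R₂))
    ∣R₁∪R₂∣≡t+t : ∣ R₁ ∪ R₂ ∣ ≡ t + t
    ∣R₁∪R₂∣≡t+t = trans (∣p∪q∣≡∣p∣+∣q∣ (λ r∈R₁ r∈R₂ → proj₂ (R₁⁻ r∈R₁) (proj₁ (R₂⁻ r∈R₂)))) (cong₂ _+_ ∣R₁∣≡t ∣R₂∣≡t)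

  2q∸t≡t+∣Sℓ∣ : 2 * q ∸ t ≡ t + ∣ Sℓ ∣
  2q∸t≡t+∣Sℓ∣ = trans (cong (_∸ t) 2q≡t+[t+∣Sℓ∣]) (ℕ.m+n∸m≡n t _)

  2q∸2t≡∣Sℓ∣ : 2 * q ∸ 2 * t ≡ ∣ Sℓ ∣
  2q∸2t≡∣Sℓ∣ = begin
    2 * q ∸ 2 * t               ≡⟨ cong (2 * q ∸_) (cong (t +_) (ℕ.+-identityʳ t)) ⟩
    2 * q ∸ (t + t)             ≡⟨ ℕ.∸-+-assoc (2 * q) t t ⟨
    2 * q ∸ t ∸ t               ≡⟨ cong (_∸ t) 2q∸t≡t+∣Sℓ∣ ⟩
    t + ∣ Sℓ ∣ ∸ t              ≡⟨ ℕ.m+n∸m≡n t _ ⟩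
    ∣ Sℓ ∣                      ∎
    where open ≡-Reasoning

  ∣T∣≢1 : ∣ T ∣ ≢ 1
  ∣T∣≢1 ∣T∣≡1 with 0<∣p∣⇒Nonempty (subst (0 <_) (sym ∣T∣≡1) (s≤s z≤n))
  ... | X , X∈T with secant-exists X∈T
  ...   | Z , Z∈C , W , W∈S , W≢X , W∈XZ = W≢X (∣p∣≡1⇒≡ ∣T∣≡1 (secant-point-in-T X∈T Z∈C W∈S W≢X W∈XZ) X∈T)

  part-a : ∣ S ∣ ≢ 2 * q ∸ 2 * t + 1
  part-a ∣S∣≡ = ∣T∣≢1 (ℕ.+-cancelˡ-≡ ∣ Sℓ ∣ _ _ (trans (sym ∣S∣≡∣Sℓ∣+∣T∣) (trans ∣S∣≡ (cong (_+ 1) 2q∸2t≡∣Sℓ∣))))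

  φ : Point → Point → Point
  φ r X = (X ∨ r) ∧ ℓ₂

  X≢r : X ∈ T → r ∈ R₁ → X ≢ r
  X≢r X∈T r∈R₁ = T≢C X∈T (R₁⊆C r∈R₁)

  X∨r≢ℓ₂ : X ∈ T → r ∈ R₁ → X ∨ r ≢ ℓ₂
  X∨r≢ℓ₂ X∈T r∈R₁ = ∈∉⇒lines≢ (∨-incidentˡ (X≢r X∈T r∈R₁)) (T∉L₂ X∈T)

  φ∈X∨r : X ∈ T → r ∈ R₁ → φ r X ∈ L (X ∨ r)
  φ∈X∨r X∈T r∈R₁ = ∧-incidentˡ (X∨r≢ℓ₂ X∈T r∈R₁)

  φ∈L₂ : X ∈ T → r ∈ R₁ → φ r X ∈ L₂
  φ∈L₂ X∈T r∈R₁ = ∧-incidentʳ (X∨r≢ℓ₂ X∈T r∈R₁)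

  φ∈R₂ : X ∈ T → r ∈ R₁ → φ r X ∈ R₂
  φ∈R₂ {X} {r} X∈T r∈R₁ = T-R₁-line-meets-ℓ₂-in-R₂ X∈T r∈R₁ (∨-incidentˡ X≢r′) (∨-incidentʳ X≢r′)
                    (φ∈X∨r X∈T r∈R₁) (φ∈L₂ X∈T r∈R₁)
    where
    X≢r′ : X ≢ r
    X≢r′ = X≢r X∈T r∈R₁

  φ-collision : X ∈ T → Y ∈ T → r ∈ R₁ → φ r X ≡ φ r Y → Y ∈ L (X ∨ r)
  φ-collision {X} {Y} {r} X∈T Y∈T r∈R₁ φX≡φY = subst (λ ℓ → Y ∈ L ℓ) Yr≡Xr (∨-incidentˡ (X≢r Y∈T r∈R₁))
    where
    r≢φ : r ≢ φ r X
    r≢φ = ∈∉⇒≢ (φ∈L₂ X∈T r∈R₁) (proj₂ (R₁⁻ r∈R₁)) ∘ sym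
    Yr≡Xr : Y ∨ r ≡ X ∨ r
    Yr≡Xr = lines-coincide r≢φ (∨-incidentʳ (X≢r Y∈T r∈R₁)) (subst (_∈ L _) (sym φX≡φY) (φ∈X∨r Y∈T r∈R₁))
                               (∨-incidentʳ (X≢r X∈T r∈R₁)) (φ∈X∨r X∈T r∈R₁)

  collision⇒secant : X ∈ T → Y ∈ T → Y ≢ X → r ∈ R₁ → φ r X ≡ φ r Y → Secant X r
  collision⇒secant X∈T Y∈T Y≢X r∈R₁ φX≡φY = _ , T⊆S Y∈T , Y≢X , φ-collision X∈T Y∈T r∈R₁ φX≡φY

  φ-distinct : X ∈ T → r ∈ R₁ → Z ∈ R₁ → r ≢ Z → φ r X ≢ φ Z X
  φ-distinct {X} {r} {Z} X∈T r∈R₁ Z∈R₁ r≢Z φr≡φZ = T∉L₁ X∈T (subst (λ ℓ → X ∈ L ℓ) Xr≡ℓ₁ (∨-incidentˡ X≢r′))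
    where
    X≢r′ : X ≢ r
    X≢r′ = X≢r X∈T r∈R₁
    X≢Z : X ≢ Z
    X≢Z = X≢r X∈T Z∈R₁
    Xr≡XZ : X ∨ r ≡ X ∨ Z
    Xr≡XZ = lines-coincide (∈∉⇒≢ (φ∈L₂ X∈T r∈R₁) (T∉L₂ X∈T) ∘ sym)
              (∨-incidentˡ X≢r′) (φ∈X∨r X∈T r∈R₁) (∨-incidentˡ X≢Z) (subst (_∈ L _) (sym φr≡φZ) (φ∈X∨r X∈T Z∈R₁))
    Xr≡ℓ₁ : X ∨ r ≡ ℓ₁
    Xr≡ℓ₁ = lines-coincide r≢Z (∨-incidentʳ X≢r′) (subst (λ ℓ → Z ∈ L ℓ) (sym Xr≡XZ) (∨-incidentʳ X≢Z))
              (proj₁ (R₁⁻ r∈R₁)) (proj₁ (R₁⁻ Z∈R₁))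

  ∣T∣≤t-if-secant-free : r ∈ R₁ → (∀ {X} → X ∈ T → ¬ Secant X r) → ∣ T ∣ ≤ t
  ∣T∣≤t-if-secant-free {r} r∈R₁ secant-free =
    subst (∣ T ∣ ≤_) ∣R₂∣≡t (∣p∣≤∣q∣-by-injection (φ r) (λ X∈T → φ∈R₂ X∈T r∈R₁) injective)
    where
    injective : ∀ {X Y} → X ∈ T → Y ∈ T → φ r X ≡ φ r Y → X ≡ Y
    injective {X} {Y} X∈T Y∈T φX≡φY with Y ≟ X
    ... | yes Y≡X = sym Y≡X
    ... | no Y≢X = ⊥-elim (secant-free X∈T (collision⇒secant X∈T Y∈T Y≢X r∈R₁ φX≡φY))

  ∨-shared : X ∈ T → Y ∈ T → Z ∈ C → Y ∈ L (X ∨ Z) → Y ∨ Z ≡ X ∨ Z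
  ∨-shared X∈T Y∈T Z∈C Y∈XZ = lines-coincide (T≢C Y∈T Z∈C) (∨-incidentˡ (T≢C Y∈T Z∈C)) (∨-incidentʳ (T≢C Y∈T Z∈C))
                                Y∈XZ (∨-incidentʳ (T≢C X∈T Z∈C))

  secant-partner : X ∈ T → Y ∈ T → Y ≢ X → Z ∈ C → Y ∈ L (X ∨ Z) → Secant Y Z
  secant-partner X∈T Y∈T Y≢X Z∈C Y∈XZ =
    _ , T⊆S X∈T , Y≢X ∘ sym , subst (λ ℓ → _ ∈ L ℓ) (sym (∨-shared X∈T Y∈T Z∈C Y∈XZ)) (∨-incidentˡ (T≢C X∈T Z∈C))

  -- Double counting: every r ∈ R₁ other than r₀ is the secant point of at least two points of
  -- U = {X ∈ T ∣ r₀ is not a secant point of X}, while φ r₀ embeds U into R₂ minus a point.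
  module AllSecant {r₀ : Point} (r₀∈R₁ : r₀ ∈ R₁) (secant-at : ∀ {Z} → Z ∈ R₁ → ∃[ X ] (X ∈ T × Secant X Z)) where

    X₀ : Point
    X₀ = proj₁ (secant-at r₀∈R₁)

    X₀∈T : X₀ ∈ T
    X₀∈T = proj₁ (proj₂ (secant-at r₀∈R₁))

    secant₀ : Secant X₀ r₀
    secant₀ = proj₂ (proj₂ (secant-at r₀∈R₁))

    U? : ∀ X → Dec (X ∈ T × ¬ Secant X r₀)
    U? X = X ∈? T ×-dec ¬? (secant? X r₀)

    U : Subset (numPts q)
    U = tabulate (does ∘ U?)

    ∣U∣≤∣R₂-φX₀∣ : ∣ U ∣ ≤ ∣ R₂ - φ r₀ X₀ ∣
    ∣U∣≤∣R₂-φX₀∣ = ∣p∣≤∣q∣-by-injection (φ r₀) into injective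
      where
      into : X ∈ U → φ r₀ X ∈ R₂ - φ r₀ X₀
      into X∈U with x∈tabulate⁻ U? X∈U
      ... | X∈T , ¬secant = x∈p∧x≢y⇒x∈p-y (φ∈R₂ X∈T r₀∈R₁) λ φX≡φX₀ →
        ¬secant (collision⇒secant X∈T X₀∈T (λ { refl → ¬secant secant₀ }) r₀∈R₁ φX≡φX₀)
      injective : ∀ {X Y} → X ∈ U → Y ∈ U → φ r₀ X ≡ φ r₀ Y → X ≡ Y
      injective {X} {Y} X∈U Y∈U φX≡φY with x∈tabulate⁻ U? X∈U | x∈tabulate⁻ U? Y∈U | Y ≟ X
      ... | _ | _ | yes Y≡X = sym Y≡X
      ... | X∈T , ¬secant | Y∈T , _ | no Y≢X = ⊥-elim (¬secant (collision⇒secant X∈T Y∈T Y≢X r₀∈R₁ φX≡φY))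

    SecantInR₁ : Point → Point → Set
    SecantInR₁ X Z = Z ∈ R₁ × Secant X Z

    two-in-U : Z ∈ R₁ - r₀ → ∃[ X ] ∃[ Y ] (X ≢ Y × X ∈ U × Y ∈ U × SecantInR₁ X Z × SecantInR₁ Y Z)
    two-in-U {Z} Z∈ with x∈p-y⁻ Z∈ | secant-at (proj₁ (x∈p-y⁻ Z∈))
    ... | Z∈R₁ , Z≢r₀ | X , X∈T , secant@(Y , Y∈S , Y≢X , Y∈XZ) =
      X , Y , Y≢X ∘ sym , x∈tabulate⁺ U? (X∈T , avoids-r₀ X∈T secant) , x∈tabulate⁺ U? (Y∈T , avoids-r₀ Y∈T secantY) ,
      (Z∈R₁ , secant) , (Z∈R₁ , secantY)
      where
      Y∈T : Y ∈ T
      Y∈T = secant-point-in-T X∈T (R₁⊆C Z∈R₁) Y∈S Y≢X Y∈XZ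
      secantY : Secant Y Z
      secantY = secant-partner X∈T Y∈T Y≢X (R₁⊆C Z∈R₁) Y∈XZ
      avoids-r₀ : ∀ {W} → W ∈ T → Secant W Z → ¬ Secant W r₀
      avoids-r₀ W∈T secant secant₀ = Z≢r₀ (secant-unique W∈T (R₁⊆C Z∈R₁) (R₁⊆C r₀∈R₁) secant secant₀)

    2∣R₁-r₀∣≤∣U∣ : ∣ R₁ - r₀ ∣ + ∣ R₁ - r₀ ∣ ≤ ∣ U ∣
    2∣R₁-r₀∣≤∣U∣ = ∣p∣+∣p∣≤∣q∣-by-two-to-one SecantInR₁
      (λ X∈U (Z∈R₁ , secant) (Z′∈R₁ , secant′) →
        secant-unique (proj₁ (x∈tabulate⁻ U? X∈U)) (R₁⊆C Z∈R₁) (R₁⊆C Z′∈R₁) secant secant′)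
      two-in-U

    ∣R₂-φX₀∣≡∣R₁-r₀∣ : ∣ R₂ - φ r₀ X₀ ∣ ≡ ∣ R₁ - r₀ ∣
    ∣R₂-φX₀∣≡∣R₁-r₀∣ = ℕ.suc-injective (begin
      suc ∣ R₂ - φ r₀ X₀ ∣  ≡⟨ ∣p∣≡1+∣p-x∣ (φ∈R₂ X₀∈T r₀∈R₁) ⟨
      ∣ R₂ ∣                ≡⟨ trans ∣R₂∣≡t (sym ∣R₁∣≡t) ⟩
      ∣ R₁ ∣                ≡⟨ ∣p∣≡1+∣p-x∣ r₀∈R₁ ⟩
      suc ∣ R₁ - r₀ ∣       ∎)
      where open ≡-Reasoning

    t≡1 : t ≡ 1
    t≡1 = begin
      t                ≡⟨ sym ∣R₁∣≡t ⟩
      ∣ R₁ ∣           ≡⟨ ∣p∣≡1+∣p-x∣ r₀∈R₁ ⟩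
      suc ∣ R₁ - r₀ ∣  ≡⟨ cong suc (ℕ.n≤0⇒n≡0 (ℕ.+-cancelˡ-≤ ∣ R₁ - r₀ ∣ ∣ R₁ - r₀ ∣ 0 2k≤k+0)) ⟩
      1                ∎
      where
      open ≡-Reasoning
      2k≤k+0 : ∣ R₁ - r₀ ∣ + ∣ R₁ - r₀ ∣ ≤ ∣ R₁ - r₀ ∣ + 0
      2k≤k+0 = ℕ.≤-trans 2∣R₁-r₀∣≤∣U∣ (ℕ.≤-trans ∣U∣≤∣R₂-φX₀∣
                 (ℕ.≤-reflexive (trans ∣R₂-φX₀∣≡∣R₁-r₀∣ (sym (ℕ.+-identityʳ _)))))

  ∣T∣≤t : 1 < t → ∣ T ∣ ≤ t
  ∣T∣≤t 1<t with any? (λ r → r ∈? R₁ ×-dec ¬? (any? λ X → X ∈? T ×-dec secant? X r))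
  ... | yes (r , r∈R₁ , ∄X) = ∣T∣≤t-if-secant-free r∈R₁ λ X∈T secant → ∄X (_ , X∈T , secant)
  ... | no ∄r = ⊥-elim (ℕ.<-irrefl (sym (AllSecant.t≡1 (proj₂ r₀) secant-at)) 1<t)
    where
    r₀ : Nonempty R₁
    r₀ = 0<∣p∣⇒Nonempty (subst (0 <_) (sym ∣R₁∣≡t) (ℕ.<-trans (s≤s z≤n) 1<t))
    secant-at : ∀ {r} → r ∈ R₁ → ∃[ X ] (X ∈ T × Secant X r)
    secant-at {r} r∈R₁ with any? (λ X → X ∈? T ×-dec secant? X r)
    ... | yes secant = secant
    ... | no ∄X = ⊥-elim (∄r (r , r∈R₁ , ∄X))

  part-c : 1 < t → ∣ S ∣ ≤ 2 * q ∸ t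
  part-c 1<t = begin
    ∣ S ∣            ≡⟨ ∣S∣≡∣Sℓ∣+∣T∣ ⟩
    ∣ Sℓ ∣ + ∣ T ∣   ≤⟨ ℕ.+-monoʳ-≤ ∣ Sℓ ∣ (∣T∣≤t 1<t) ⟩
    ∣ Sℓ ∣ + t       ≡⟨ ℕ.+-comm ∣ Sℓ ∣ t ⟩
    t + ∣ Sℓ ∣       ≡⟨ 2q∸t≡t+∣Sℓ∣ ⟨
    2 * q ∸ t        ∎
    where open ℕ.≤-Reasoning

  T-empty⇒S≡Sℓ : Empty T → S ≡ Sℓ
  T-empty⇒S≡Sℓ T-empty = ⊆-antisym S⊆Sℓ (p∩q⊆q _ S)
    where
    S⊆Sℓ : S ⊆ Sℓ
    S⊆Sℓ {X} X∈S with X ∈? Sℓ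
    ... | yes X∈Sℓ = X∈Sℓ
    ... | no X∉Sℓ = ⊥-elim (T-empty (X , subst (X ∈_) S─Sℓ≡T (x∈p∧x∉q⇒x∈p─q X∈S X∉Sℓ)))

  module FanoCase (t≡2 : t ≡ 2) {X : Point} (X∈T : X ∈ T) where

    ∣R₁∣≡2 : ∣ R₁ ∣ ≡ 2
    ∣R₁∣≡2 = trans ∣R₁∣≡t t≡2

    ∣R₂∣≡2 : ∣ R₂ ∣ ≡ 2
    ∣R₂∣≡2 = trans ∣R₂∣≡t t≡2

    Z₀ : Point
    Z₀ = proj₁ (secant-exists X∈T)
    Z₀∈C : Z₀ ∈ C
    Z₀∈C = proj₁ (proj₂ (secant-exists X∈T))
    secant-Z₀ : Secant X Z₀
    secant-Z₀ = proj₂ (proj₂ (secant-exists X∈T))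
    X′ : Point
    X′ = proj₁ secant-Z₀
    X′∈S : X′ ∈ S
    X′∈S = proj₁ (proj₂ secant-Z₀)
    X′≢X : X′ ≢ X
    X′≢X = proj₁ (proj₂ (proj₂ secant-Z₀))
    X′∈XZ₀ : X′ ∈ L (X ∨ Z₀)
    X′∈XZ₀ = proj₂ (proj₂ (proj₂ secant-Z₀))
    X′∈T : X′ ∈ T
    X′∈T = secant-point-in-T X∈T Z₀∈C X′∈S X′≢X X′∈XZ₀

    1<∣R₁∣ : 1 < ∣ R₁ ∣
    1<∣R₁∣ = subst (1 <_) (sym ∣R₁∣≡2) (s≤s (s≤s z≤n))

    1<∣R₂∣ : 1 < ∣ R₂ ∣
    1<∣R₂∣ = subst (1 <_) (sym ∣R₂∣≡2) (s≤s (s≤s z≤n))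

    ∣R₂∣≤2 : ∣ R₂ ∣ ≤ 2
    ∣R₂∣≤2 = ℕ.≤-reflexive ∣R₂∣≡2

    -- If Z₀ ∈ R₁, the other point r′ of R₁ would be a secant point of X as well: φ r′ X and
    -- φ r′ X′ both differ from φ Z₀ X = φ Z₀ X′, so they coincide in the two-point set R₂.
    Z₀≡V : Z₀ ≡ V
    Z₀≡V with Z₀ ∈? L₂
    ... | yes Z₀∈L₂ = ≡V (proj₁ (C⁻ Z₀∈C)) Z₀∈L₂
    ... | no Z₀∉L₂ = ⊥-elim (r′≢Z₀ (secant-unique X∈T (R₁⊆C r′∈R₁) Z₀∈C secant-r′ secant-Z₀))
      where
      Z₀∈R₁ : Z₀ ∈ R₁
      Z₀∈R₁ = ∉S⇒∈R₁ (proj₁ (C⁻ Z₀∈C)) Z₀∉L₂ (proj₂ (C⁻ Z₀∈C))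
      r′ : Point
      r′ = proj₁ (1<∣p∣⇒∃≢ {p = R₁} 1<∣R₁∣ Z₀)
      r′∈R₁ : r′ ∈ R₁
      r′∈R₁ = proj₁ (proj₂ (1<∣p∣⇒∃≢ {p = R₁} 1<∣R₁∣ Z₀))
      r′≢Z₀ : r′ ≢ Z₀
      r′≢Z₀ = proj₂ (proj₂ (1<∣p∣⇒∃≢ {p = R₁} 1<∣R₁∣ Z₀))
      φZ₀X′≡φZ₀X : φ Z₀ X′ ≡ φ Z₀ X
      φZ₀X′≡φZ₀X = cong (_∧ ℓ₂) (∨-shared X∈T X′∈T Z₀∈C X′∈XZ₀)
      φr′X′≡φr′X : φ r′ X′ ≡ φ r′ X
      φr′X′≡φr′X = ∣p∣≤2⇒≡ ∣R₂∣≤2 (φ∈R₂ X∈T Z₀∈R₁) (φ∈R₂ X∈T r′∈R₁) (φ∈R₂ X′∈T r′∈R₁)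
        (φ-distinct X∈T r′∈R₁ Z₀∈R₁ r′≢Z₀) (λ φr′X′≡φZ₀X → φ-distinct X′∈T r′∈R₁ Z₀∈R₁ r′≢Z₀ (trans φr′X′≡φZ₀X (sym φZ₀X′≡φZ₀X)))
      secant-r′ : Secant X r′
      secant-r′ = collision⇒secant X∈T X′∈T X′≢X r′∈R₁ (sym φr′X′≡φr′X)

    X′∈XV : X′ ∈ L (X ∨ V)
    X′∈XV = subst (λ W → X′ ∈ L (X ∨ W)) Z₀≡V X′∈XZ₀

    secant-V : Secant X V
    secant-V = X′ , X′∈S , X′≢X , X′∈XV

    ∣T∣≤2 : ∣ T ∣ ≤ 2
    ∣T∣≤2 = subst (∣ T ∣ ≤_) t≡2 (∣T∣≤t (subst (1 <_) (sym t≡2) (s≤s (s≤s z≤n))))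

    T-pair : ∀ {W} → W ∈ T → W ≡ X ⊎ W ≡ X′
    T-pair = ∣p∣≤2⇒pair ∣T∣≤2 X∈T X′∈T (X′≢X ∘ sym)

    ∣S∣≡2q∸2 : ∣ S ∣ ≡ 2 * q ∸ 2
    ∣S∣≡2q∸2 = begin
      ∣ S ∣           ≡⟨ ∣S∣≡∣Sℓ∣+∣T∣ ⟩
      ∣ Sℓ ∣ + ∣ T ∣  ≡⟨ cong (∣ Sℓ ∣ +_) ∣T∣≡2 ⟩
      ∣ Sℓ ∣ + 2      ≡⟨ ℕ.+-comm ∣ Sℓ ∣ 2 ⟩
      2 + ∣ Sℓ ∣      ≡⟨ subst (λ s → 2 * q ∸ s ≡ s + ∣ Sℓ ∣) t≡2 2q∸t≡t+∣Sℓ∣ ⟨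
      2 * q ∸ 2       ∎
      where
      open ≡-Reasoning
      ∣T∣≡2 : ∣ T ∣ ≡ 2
      ∣T∣≡2 = ℕ.≤-antisym ∣T∣≤2 (subst (2 ≤_) (sym (∣p∣≡2+∣p-x-y∣ X∈T X′∈T (X′≢X ∘ sym))) (s≤s (s≤s z≤n)))

    a : Point
    a = proj₁ (0<∣p∣⇒Nonempty {p = R₁} (subst (0 <_) (sym ∣R₁∣≡2) (s≤s z≤n)))
    a∈R₁ : a ∈ R₁
    a∈R₁ = proj₂ (0<∣p∣⇒Nonempty {p = R₁} (subst (0 <_) (sym ∣R₁∣≡2) (s≤s z≤n)))
    b : Point
    b = proj₁ (1<∣p∣⇒∃≢ {p = R₁} 1<∣R₁∣ a)
    b∈R₁ : b ∈ R₁
    b∈R₁ = proj₁ (proj₂ (1<∣p∣⇒∃≢ {p = R₁} 1<∣R₁∣ a))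
    b≢a : b ≢ a
    b≢a = proj₂ (proj₂ (1<∣p∣⇒∃≢ {p = R₁} 1<∣R₁∣ a))
    c : Point
    c = φ a X
    c∈R₂ : c ∈ R₂
    c∈R₂ = φ∈R₂ X∈T a∈R₁
    d : Point
    d = proj₁ (1<∣p∣⇒∃≢ {p = R₂} 1<∣R₂∣ c)
    d∈R₂ : d ∈ R₂
    d∈R₂ = proj₁ (proj₂ (1<∣p∣⇒∃≢ {p = R₂} 1<∣R₂∣ c))
    d≢c : d ≢ c
    d≢c = proj₂ (proj₂ (1<∣p∣⇒∃≢ {p = R₂} 1<∣R₂∣ c))

    φbX≡d : φ b X ≡ d
    φbX≡d = ∣p∣≤2⇒≡ ∣R₂∣≤2 c∈R₂ d∈R₂ (φ∈R₂ X∈T b∈R₁) d≢c (φ-distinct X∈T b∈R₁ a∈R₁ b≢a)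

    -- φ a X′ = c would make a a second secant point of X, besides V.
    φaX′≡d : φ a X′ ≡ d
    φaX′≡d = ∣p∣≤2⇒≡ ∣R₂∣≤2 c∈R₂ d∈R₂ (φ∈R₂ X′∈T a∈R₁) d≢c λ φaX′≡c →
      let a≡V = secant-unique X∈T (R₁⊆C a∈R₁) V∈C (collision⇒secant X∈T X′∈T X′≢X a∈R₁ (sym φaX′≡c)) secant-V
      in proj₂ (R₁⁻ a∈R₁) (subst (_∈ L₂) (sym a≡V) V∈L₂)

    φbX′≡c : φ b X′ ≡ c
    φbX′≡c = ∣p∣≤2⇒≡ ∣R₂∣≤2 d∈R₂ c∈R₂ (φ∈R₂ X′∈T b∈R₁) (d≢c ∘ sym)
      λ φbX′≡d → φ-distinct X′∈T b∈R₁ a∈R₁ b≢a (trans φbX′≡d (sym φaX′≡d))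

    a∈L₁ : a ∈ L₁
    a∈L₁ = proj₁ (R₁⁻ a∈R₁)
    b∈L₁ : b ∈ L₁
    b∈L₁ = proj₁ (R₁⁻ b∈R₁)
    c∈L₂ : c ∈ L₂
    c∈L₂ = proj₁ (R₂⁻ c∈R₂)
    d∈L₂ : d ∈ L₂
    d∈L₂ = proj₁ (R₂⁻ d∈R₂)
    X≢a : X ≢ a
    X≢a = X≢r X∈T a∈R₁
    X≢b : X ≢ b
    X≢b = X≢r X∈T b∈R₁
    X′≢a : X′ ≢ a
    X′≢a = X≢r X′∈T a∈R₁
    X′≢b : X′ ≢ b
    X′≢b = X≢r X′∈T b∈R₁
    X≢V : X ≢ V
    X≢V = T≢C X∈T V∈C

    point : FanoPoint → Point
    point F.a = a
    point F.b = b
    point F.c = c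
    point F.d = d
    point F.ab∧cd = V
    point F.ac∧bd = X
    point F.ad∧bc = X′

    line : FanoLine → Line
    line F.ab = ℓ₁
    line F.cd = ℓ₂
    line F.ac = X ∨ a
    line F.bd = X ∨ b
    line F.ad = X′ ∨ a
    line F.bc = X′ ∨ b
    line F.diagonal = X ∨ V

    preserves : Preserves point line
    preserves F.ab = a∈L₁ ∷ b∈L₁ ∷ V∈L₁ ∷ []
    preserves F.cd = c∈L₂ ∷ d∈L₂ ∷ V∈L₂ ∷ []
    preserves F.ac = ∨-incidentʳ X≢a ∷ φ∈X∨r X∈T a∈R₁ ∷ ∨-incidentˡ X≢a ∷ []
    preserves F.bd = ∨-incidentʳ X≢b ∷ subst (_∈ L (X ∨ b)) φbX≡d (φ∈X∨r X∈T b∈R₁) ∷ ∨-incidentˡ X≢b ∷ []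
    preserves F.ad = ∨-incidentʳ X′≢a ∷ subst (_∈ L (X′ ∨ a)) φaX′≡d (φ∈X∨r X′∈T a∈R₁) ∷ ∨-incidentˡ X′≢a ∷ []
    preserves F.bc = ∨-incidentʳ X′≢b ∷ subst (_∈ L (X′ ∨ b)) φbX′≡c (φ∈X∨r X′∈T b∈R₁) ∷ ∨-incidentˡ X′≢b ∷ []
    preserves F.diagonal = ∨-incidentʳ X≢V ∷ ∨-incidentˡ X≢V ∷ X′∈XV ∷ []

    avoids-ab : Avoids point line F.ab
    avoids-ab = proj₂ (R₂⁻ c∈R₂) ∷ proj₂ (R₂⁻ d∈R₂) ∷ T∉L₁ X∈T ∷ T∉L₁ X′∈T ∷ []

    avoids-cd : Avoids point line F.cd
    avoids-cd = proj₂ (R₁⁻ a∈R₁) ∷ proj₂ (R₁⁻ b∈R₁) ∷ T∉L₂ X∈T ∷ T∉L₂ X′∈T ∷ []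

    avoids-ac : Avoids point line F.ac
    avoids-ac = off-other-line Xa≢ℓ₁ (∨-incidentʳ X≢a) a∈L₁ b∈L₁ b≢a
              ∷ off-other-line Xa≢ℓ₂ (φ∈X∨r X∈T a∈R₁) c∈L₂ d∈L₂ d≢c
              ∷ off-other-line Xa≢ℓ₁ (∨-incidentʳ X≢a) a∈L₁ V∈L₁ V≢a
              ∷ off-other-line Xa≢XV (∨-incidentˡ X≢a) (∨-incidentˡ X≢V) X′∈XV X′≢X
              ∷ []
      where
      V≢a : V ≢ a
      V≢a = ∈∉⇒≢ V∈L₂ (proj₂ (R₁⁻ a∈R₁))
      Xa≢ℓ₁ : X ∨ a ≢ ℓ₁
      Xa≢ℓ₁ = ∈∉⇒lines≢ (∨-incidentˡ X≢a) (T∉L₁ X∈T)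
      Xa≢ℓ₂ : X ∨ a ≢ ℓ₂
      Xa≢ℓ₂ = ∈∉⇒lines≢ (∨-incidentˡ X≢a) (T∉L₂ X∈T)
      a∉XV : a ∉ L (X ∨ V)
      a∉XV = off-other-line (∈∉⇒lines≢ (∨-incidentˡ X≢V) (T∉L₁ X∈T)) (∨-incidentʳ X≢V) V∈L₁ a∈L₁ (V≢a ∘ sym)
      Xa≢XV : X ∨ a ≢ X ∨ V
      Xa≢XV = ∈∉⇒lines≢ (∨-incidentʳ X≢a) a∉XV

    Πs : Subset (numPts q)
    Πs = image point

    Λ : Subset (numPts q)
    Λ = image line

    on-lines⇒∉Πs : P ∈ S → P ∈ L₁ ∪ L₂ → P ∉ Πs
    on-lines⇒∉Πs P∈S P∈L P∈Πs with ∈image⁻ point P∈Πs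
    ... | F.a , refl = R₁∉S a∈R₁ P∈S
    ... | F.b , refl = R₁∉S b∈R₁ P∈S
    ... | F.c , refl = R₂∉S c∈R₂ P∈S
    ... | F.d , refl = R₂∉S d∈R₂ P∈S
    ... | F.ab∧cd , refl = V∉S P∈S
    ... | F.ac∧bd , refl = [ T∉L₁ X∈T , T∉L₂ X∈T ] (x∈p∪q⁻ L₁ L₂ P∈L)
    ... | F.ad∧bc , refl = [ T∉L₁ X′∈T , T∉L₂ X′∈T ] (x∈p∪q⁻ L₁ L₂ P∈L)

    off-lines⇒∈S : P ∈ Πs → P ∉ L₁ ∪ L₂ → P ∈ S
    off-lines⇒∈S P∈Πs P∉L with ∈image⁻ point P∈Πs
    ... | F.a , refl = ⊥-elim (P∉L (x∈p∪q⁺ (inj₁ a∈L₁)))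
    ... | F.b , refl = ⊥-elim (P∉L (x∈p∪q⁺ (inj₁ b∈L₁)))
    ... | F.c , refl = ⊥-elim (P∉L (x∈p∪q⁺ (inj₂ c∈L₂)))
    ... | F.d , refl = ⊥-elim (P∉L (x∈p∪q⁺ (inj₂ d∈L₂)))
    ... | F.ab∧cd , refl = ⊥-elim (P∉L (x∈p∪q⁺ (inj₁ V∈L₁)))
    ... | F.ac∧bd , refl = T⊆S X∈T
    ... | F.ad∧bc , refl = X′∈S

    R₁-pair : ∀ {r} → r ∈ R₁ → r ≡ a ⊎ r ≡ b
    R₁-pair = ∣p∣≤2⇒pair (ℕ.≤-reflexive ∣R₁∣≡2) a∈R₁ b∈R₁ (b≢a ∘ sym)

    R₂-pair : ∀ {r} → r ∈ R₂ → r ≡ c ⊎ r ≡ d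
    R₂-pair = ∣p∣≤2⇒pair ∣R₂∣≤2 c∈R₂ d∈R₂ (d≢c ∘ sym)

    on-lines-∉S⇒∈Πs : P ∈ L₁ ∪ L₂ → P ∉ S → P ∈ Πs
    on-lines-∉S⇒∈Πs {P} P∈L P∉S with P ∈? L₁ | P ∈? L₂
    ... | yes P∈L₁ | yes P∈L₂ = subst (_∈ Πs) (sym (≡V P∈L₁ P∈L₂)) (f∈image point F.ab∧cd)
    ... | yes P∈L₁ | no P∉L₂ = case R₁-pair (∉S⇒∈R₁ P∈L₁ P∉L₂ P∉S) of λ where
      (inj₁ refl) → f∈image point F.a
      (inj₂ refl) → f∈image point F.b
    ... | no P∉L₁ | yes P∈L₂ = case R₂-pair (∉S⇒∈R₂ P∈L₂ P∉L₁ P∉S) of λ where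
      (inj₁ refl) → f∈image point F.c
      (inj₂ refl) → f∈image point F.d
    ... | no P∉L₁ | no P∉L₂ = ⊥-elim ([ P∉L₁ , P∉L₂ ] (x∈p∪q⁻ L₁ L₂ P∈L))

    S≡ℓ₁∪ℓ₂△Πs : S ≡ (L₁ ∪ L₂) △ Πs
    S≡ℓ₁∪ℓ₂△Πs = ⊆-antisym ⊆-△ ⊇-△
      where
      ⊆-△ : S ⊆ (L₁ ∪ L₂) △ Πs
      ⊆-△ {P} P∈S with P ∈? L₁ ∪ L₂
      ... | yes P∈L = x∈p△q⁺ˡ P∈L (on-lines⇒∉Πs P∈S P∈L)
      ... | no P∉L with T-pair (T⁺ P∈S (P∉L ∘ x∈p∪q⁺ ∘ inj₁) (P∉L ∘ x∈p∪q⁺ ∘ inj₂))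
      ...   | inj₁ refl = x∈p△q⁺ʳ P∉L (f∈image point F.ac∧bd)
      ...   | inj₂ refl = x∈p△q⁺ʳ P∉L (f∈image point F.ad∧bc)
      ⊇-△ : (L₁ ∪ L₂) △ Πs ⊆ S
      ⊇-△ {P} P∈ with x∈p△q⁻ (L₁ ∪ L₂) Πs P∈ | P ∈? S
      ... | _ | yes P∈S = P∈S
      ... | inj₁ (P∈L , P∉Πs) | no P∉S = ⊥-elim (P∉Πs (on-lines-∉S⇒∈Πs P∈L P∉S))
      ... | inj₂ (P∈Πs , P∉L) | no _ = off-lines⇒∈S P∈Πs P∉L

    fano-configuration : ∣ S ∣ ≡ 2 * q ∸ 2
      × ∃[ Πs ] ∃[ Λ ] ∃[ m₁ ] ∃[ m₂ ]
          (IsFanoSubplane Π Πs Λ × m₁ ∈ Λ × m₂ ∈ Λ × m₁ ≢ m₂ × S ≡ (L m₁ ∪ L m₂) △ Πs)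
    fano-configuration = ∣S∣≡2q∸2 , Πs , Λ , ℓ₁ , ℓ₂ ,
      isFanoSubplane point line preserves avoids-ab avoids-cd avoids-ac ,
      f∈image line F.ab , f∈image line F.cd , ℓ₁≢ℓ₂ , S≡ℓ₁∪ℓ₂△Πs

  part-b : t ≡ 2 → IsVConfig Π 2 S
    ⊎ (∣ S ∣ ≡ 2 * q ∸ 2
       × ∃[ Πs ] ∃[ Λ ] ∃[ m₁ ] ∃[ m₂ ]
           (IsFanoSubplane Π Πs Λ × m₁ ∈ Λ × m₂ ∈ Λ × m₁ ≢ m₂ × S ≡ (L m₁ ∪ L m₂) △ Πs))
  part-b t≡2 with nonempty? T
  ... | yes (X , X∈T) = inj₂ (FanoCase.fano-configuration t≡2 X∈T)
  ... | no T-empty = inj₁ (ℓ₁ , ℓ₂ , ℓ₁≢ℓ₂ , R₁ , R₂ , R₁⊆ , trans ∣R₁∣≡t t≡2 , R₂⊆ , trans ∣R₂∣≡t t≡2 ,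
                           trans (T-empty⇒S≡Sℓ T-empty) S-on-ℓ₁△ℓ₂)

proposition3p5 : ∀ {q : ℕ} (Π : ProjectivePlane q) (t : ℕ) (S : Subset (numPts q)) →
    t < q ∸ 1 → IsSemiarc Π t S → IsVcircType Π t S →
    (∣ S ∣ ≢ 2 * q ∸ 2 * t + 1)
    × (t ≡ 2 →
        IsVConfig Π 2 S
        ⊎ (∣ S ∣ ≡ 2 * q ∸ 2
           × ∃[ Πs ] ∃[ Λ ] ∃[ ℓ₁ ] ∃[ ℓ₂ ]
               (IsFanoSubplane Π Πs Λ × ℓ₁ ∈ Λ × ℓ₂ ∈ Λ × ℓ₁ ≢ ℓ₂
                × S ≡ (ProjectivePlane.L Π ℓ₁ ∪ ProjectivePlane.L Π ℓ₂) △ Πs)))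
    × (1 < t → ∣ S ∣ ≤ 2 * q ∸ t)
proposition3p5 Π t S t<q∸1 semiarc (ℓ₁ , ℓ₂ , ℓ₁≢ℓ₂ , meet∉S , _ , R₁ , R₂ , R₁⊆ , ∣R₁∣≡t , R₂⊆ , ∣R₂∣≡t , S-on-ℓ₁△ℓ₂) =
  part-a , part-b , part-c
  where open VcircSemiarc Π t<q∸1 semiarc ℓ₁≢ℓ₂ meet∉S R₁⊆ ∣R₁∣≡t R₂⊆ ∣R₂∣≡t S-on-ℓ₁△ℓ₂
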